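{- As formal power series in $q$, $$C\Phi_{2,-1}(q)=\prod_{i=1}^{\infty}\frac{(1-q^{2i})(1+q^{2i})(1+q^{2i-2})}{(1-q^i)^2}.$$
   Context: $C\Phi_{2,-1}(q)=\sum_{n\ge0}c\phi_{2,-1}(n)q^n$ is the coefficient of $z^{ -1}$ in the formal product $\prod_{\lambda=0}^{\infty}(1+zq^{\lambda+1})^2(1+z^{ -1}q^{\lambda})^2$. Equivalently, $c\phi_{2,-1}(n)$ counts two-rowed arrays (top row with $m_1$ entries, bottom row with $m_2$ entries, $m_1-m_2=-1$) of nonnegative integers each carrying one of 2 colors, with no colored integer repeated within a row, and of weight $m_1+(\text{sum of all entries})=n$. -}

module Defs where

open import Data.Nat as ℕ using (ℕ; zero; suc; _≤ᵇ_; _≡ᵇ_)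
open import Data.Nat.Divisibility using (_∣?_)
open import Data.Integer as ℤ using (ℤ; 0ℤ; 1ℤ; -1ℤ; +_)
open import Data.List using (List; map; foldr; upTo)
open import Data.Bool using (if_then_else_; _∧_)
open import Relation.Nullary using (does)

-- Formal power series in q with integer coefficients:
-- a series is its coefficient function n ↦ [q^n].

Series : Set
Series = ℕ → ℤ

mono : ℤ → ℕ → Series
mono c d n = if n ≡ᵇ d then c else 0ℤ

one : Series
one = mono 1ℤ 0

_⊕_ : Series → Series → Series
(f ⊕ g) n = f n ℤ.+ g n

_⊛_ : Series → Series → Series
(f ⊛ g) n = foldr ℤ._+_ 0ℤ (map (λ k → f k ℤ.* g (n ℕ.∸ k)) (upTo (suc n)))

-- 1 / (1 - q^i) = Σ_{j≥0} q^{ij}   (used for i ≥ 1)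
invOneMinus : ℕ → Series
invOneMinus i n = if does (i ∣? n) then 1ℤ else 0ℤ

factorR : ℕ → Series
factorR i =
  (one ⊕ mono -1ℤ (2 ℕ.* i)) ⊛ ((one ⊕ mono 1ℤ (2 ℕ.* i)) ⊛
  ((one ⊕ mono 1ℤ (2 ℕ.* i ℕ.∸ 2)) ⊛ (invOneMinus i ⊛ invOneMinus i)))

prodR : ℕ → Series
prodR zero    = one
prodR (suc N) = prodR N ⊛ factorR (suc N)

-- Series in q whose coefficients are Laurent polynomials in z:
-- F k n = [z^k q^n] F.

ZSeries : Set
ZSeries = ℤ → ℕ → ℤ

oneZ : ZSeries
oneZ k n = if does (k ℤ.≟ 0ℤ) ∧ (n ≡ᵇ 0) then 1ℤ else 0ℤ

-- multiply by (1 + z^a q^b)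
timesBin : ℤ → ℕ → ZSeries → ZSeries
timesBin a b F k n = F k n ℤ.+ (if b ≤ᵇ n then F (k ℤ.- a) (n ℕ.∸ b) else 0ℤ)

factorL : ℕ → ZSeries → ZSeries
factorL λ' F =
  timesBin 1ℤ (suc λ') (timesBin 1ℤ (suc λ')
    (timesBin -1ℤ λ' (timesBin -1ℤ λ' F)))

prodL : ℕ → ZSeries
prodL zero    = oneZ
prodL (suc N) = factorL N (prodL N)

-- The product ∏_{λ<N} (1 + z q^((λ+1)s)) (1 + z⁻¹ q^(λs)) is a finite Jacobi triple product: its
-- z^k-coefficient is q^(s k(k+1)/2) times a Gaussian binomial in q^s, which we see by checking that,
-- suitably normalised, the z-coefficients and the elementary symmetric functions of 1, q^s, …,
-- q^((2N−1)s) obey the same two-step recursion in N.  Multiplied by (q^s;q^s)_∞, each z^k-coefficient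
-- is therefore q^(s k(k+1)/2) up to terms of degree ≥ N.  So below degree N both the z⁻¹-coefficient
-- of the square of the s = 1 product times (q;q)_∞², and the s = 2 product at z = 1 times (q²;q²)_∞,
-- equal the theta series ∑_k q^(k(k+1)).  The right-hand side times (q;q)_∞² is the latter, and
-- (q;q)_∞², having constant term 1, can be cancelled.
module Submission where

open import Defs renaming (_⊛_ to infixl 7 _⊛_; _⊕_ to infixl 6 _⊕_)

open import Algebra.Bundles using (CommutativeRing)
import Algebra.Properties.CommutativeSemigroup as CommutativeSemigroupProperties
import Algebra.Solver.Ring
import Algebra.Solver.Ring.AlmostCommutativeRing as ACR
open import Algebra.Structures using (IsCommutativeRing)
open import Data.Bool using (true; false; if_then_else_)
open import Data.Empty using (⊥-elim)
open import Data.Integer as ℤ using (ℤ; 0ℤ; 1ℤ; -1ℤ)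
import Data.Integer.Properties as ℤₚ
import Data.Integer.Tactic.RingSolver as ℤ-Ring
open import Data.List using (map; foldr; applyUpTo; []; _∷_)
open import Data.Maybe using (Maybe; just; nothing)
open import Data.Nat as ℕ using (ℕ; zero; suc; _+_; _*_; _∸_; _≤_; _<_; z≤n; s≤s)
open import Data.Nat.Divisibility using (_∣_; _∣?_; ∣⇒≤; ∣-refl; ∣m+n∣m⇒∣n; ∣m∣n⇒∣m+n)
open import Data.Nat.Induction using (<-rec)
import Data.Nat.Properties as ℕₚ
import Data.Nat.Tactic.RingSolver as ℕ-Ring
open import Data.Product using (_,_)
open import Function using (_∘_; id)
open import Relation.Binary.Bundles using (Setoid)
open import Relation.Binary.PropositionalEquality
  using (_≡_; _≢_; refl; sym; trans; cong; cong₂; subst; module ≡-Reasoning)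
import Relation.Binary.Reasoning.Setoid
open import Relation.Nullary using (Dec; yes; no; does)
open import Relation.Nullary.Decidable using (dec-false)

open import Algebra.Properties.Group (CommutativeRing.+-group ℤₚ.+-*-commutativeRing) using (∙-cancelʳ)

module FiniteSum {c ℓ} (R : CommutativeRing c ℓ) where

  open CommutativeRing R
    renaming (_+_ to _+ᴿ_; _*_ to _*ᴿ_; refl to ≈-refl; sym to ≈-sym; trans to ≈-trans)
  open CommutativeSemigroupProperties +-commutativeSemigroup using (interchange)
  open import Relation.Binary.Reasoning.Setoid setoid

  ∑ : ℕ → (ℕ → Carrier) → Carrier
  ∑ zero    f = 0#
  ∑ (suc n) f = f 0 +ᴿ ∑ n (f ∘ suc)

  ∑-cong : ∀ n {f g : ℕ → Carrier} → (∀ k → k < n → f k ≈ g k) → ∑ n f ≈ ∑ n g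
  ∑-cong zero    eq = ≈-refl
  ∑-cong (suc n) eq = +-cong (eq 0 (s≤s z≤n)) (∑-cong n (λ k k<n → eq (suc k) (s≤s k<n)))

  ∑-zero : ∀ n {f : ℕ → Carrier} → (∀ k → k < n → f k ≈ 0#) → ∑ n f ≈ 0#
  ∑-zero zero    eq = ≈-refl
  ∑-zero (suc n) eq = ≈-trans (+-cong (eq 0 (s≤s z≤n)) (∑-zero n (λ k k<n → eq (suc k) (s≤s k<n)))) (+-identityˡ 0#)

  ∑-+ : ∀ n (f g : ℕ → Carrier) → ∑ n (λ k → f k +ᴿ g k) ≈ ∑ n f +ᴿ ∑ n g
  ∑-+ zero    f g = ≈-sym (+-identityˡ 0#)
  ∑-+ (suc n) f g = ≈-trans (+-congˡ (∑-+ n (f ∘ suc) (g ∘ suc)))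
    (interchange (f 0) (g 0) (∑ n (f ∘ suc)) (∑ n (g ∘ suc)))

  *-∑ : ∀ n a (f : ℕ → Carrier) → a *ᴿ ∑ n f ≈ ∑ n (λ k → a *ᴿ f k)
  *-∑ zero    a f = zeroʳ a
  *-∑ (suc n) a f = ≈-trans (distribˡ a (f 0) (∑ n (f ∘ suc))) (+-congˡ (*-∑ n a (f ∘ suc)))

  ∑-* : ∀ n a (f : ℕ → Carrier) → ∑ n f *ᴿ a ≈ ∑ n (λ k → f k *ᴿ a)
  ∑-* n a f = ≈-trans (*-comm (∑ n f) a) (≈-trans (*-∑ n a f) (∑-cong n (λ k _ → *-comm a (f k))))

  ∑-last : ∀ n (f : ℕ → Carrier) → ∑ (suc n) f ≈ ∑ n f +ᴿ f n
  ∑-last zero    f = ≈-trans (+-identityʳ (f 0)) (≈-sym (+-identityˡ (f 0)))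
  ∑-last (suc n) f = ≈-trans (+-congˡ (∑-last n (f ∘ suc))) (≈-sym (+-assoc (f 0) _ _))

  ∑-split : ∀ m n (f : ℕ → Carrier) → ∑ (m + n) f ≈ ∑ m f +ᴿ ∑ n (λ k → f (m + k))
  ∑-split zero    n f = ≈-sym (+-identityˡ _)
  ∑-split (suc m) n f = ≈-trans (+-congˡ (∑-split m n (f ∘ suc))) (≈-sym (+-assoc (f 0) _ _))

  ∑-reverse : ∀ n (f : ℕ → Carrier) → ∑ n f ≈ ∑ n (λ k → f (n ∸ suc k))
  ∑-reverse zero    f = ≈-refl
  ∑-reverse (suc n) f = begin
    ∑ (suc n) f                       ≈⟨ ∑-last n f ⟩
    ∑ n f +ᴿ f n                      ≈⟨ +-comm (∑ n f) (f n) ⟩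
    f n +ᴿ ∑ n f                      ≈⟨ +-congˡ (∑-reverse n f) ⟩
    f n +ᴿ ∑ n (λ k → f (n ∸ suc k))  ∎

  ∑-triangle : ∀ n (F : ℕ → ℕ → Carrier) →
    ∑ (suc n) (λ k → ∑ (suc (n ∸ k)) (F k)) ≈ ∑ (suc n) (λ m → ∑ (suc m) (λ k → F k (m ∸ k)))
  ∑-triangle zero    F = ≈-refl
  ∑-triangle (suc n) F = begin
    ∑ (suc (suc n)) (F 0) +ᴿ ∑ (suc n) (λ k → ∑ (suc (n ∸ k)) (F (suc k)))
      ≈⟨ +-congˡ (∑-triangle n (F ∘ suc)) ⟩
    ∑ (suc (suc n)) (F 0) +ᴿ ∑ (suc n) (λ m → ∑ (suc m) (λ k → F (suc k) (m ∸ k)))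
      ≈⟨ +-congˡ (≈-sym (+-identityˡ _)) ⟩
    ∑ (suc (suc n)) (F 0) +ᴿ ∑ (suc (suc n)) (λ m → ∑ m (λ k → F (suc k) (m ∸ suc k)))
      ≈⟨ ≈-sym (∑-+ (suc (suc n)) (F 0) (λ m → ∑ m (λ k → F (suc k) (m ∸ suc k)))) ⟩
    ∑ (suc (suc n)) (λ m → ∑ (suc m) (λ k → F k (m ∸ k))) ∎

  ∑-vanishing-tail : ∀ n m (f : ℕ → Carrier) → (∀ k → n ≤ k → f k ≈ 0#) → ∑ (n + m) f ≈ ∑ n f
  ∑-vanishing-tail n m f tail = begin
    ∑ (n + m) f                     ≈⟨ ∑-split n m f ⟩
    ∑ n f +ᴿ ∑ m (λ k → f (n + k))  ≈⟨ +-congˡ (∑-zero m (λ k _ → tail (n + k) (ℕₚ.m≤m+n n k))) ⟩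
    ∑ n f +ᴿ 0#                     ≈⟨ +-identityʳ (∑ n f) ⟩
    ∑ n f                           ∎

  ∑-single : ∀ n i (f : ℕ → Carrier) → i < n → (∀ k → k < n → k ≢ i → f k ≈ 0#) → ∑ n f ≈ f i
  ∑-single (suc n) zero    f _         others =
    ≈-trans (+-congˡ (∑-zero n (λ k k<n → others (suc k) (s≤s k<n) (λ ())))) (+-identityʳ (f 0))
  ∑-single (suc n) (suc i) f (s≤s i<n) others =
    ≈-trans (+-cong (others 0 (s≤s z≤n) (λ ()))
                    (∑-single n i (f ∘ suc) i<n (λ k k<n k≢i → others (suc k) (s≤s k<n) (k≢i ∘ ℕₚ.suc-injective))))
            (+-identityˡ (f (suc i)))

open FiniteSum ℤₚ.+-*-commutativeRing

-- The ring of formal power series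

⊛-as-∑ : ∀ f g n → (f ⊛ g) n ≡ ∑ (suc n) (λ k → f k ℤ.* g (n ∸ k))
⊛-as-∑ f g n = foldr-map (suc n) (λ k → f k ℤ.* g (n ∸ k)) id
  where
  foldr-map : ∀ m (h : ℕ → ℤ) (i : ℕ → ℕ) → foldr ℤ._+_ 0ℤ (map h (applyUpTo i m)) ≡ ∑ m (h ∘ i)
  foldr-map zero    h i = refl
  foldr-map (suc m) h i = cong (ℤ._+_ (h (i 0))) (foldr-map m h (i ∘ suc))

-- A record, so that unification never unfolds it into a Π-type.
infix 4 _≐_
record _≐_ (f g : Series) : Set where
  constructor coeffwise
  field coeff : ∀ n → f n ≡ g n
open _≐_

≐-refl : ∀ {f} → f ≐ f
≐-refl = coeffwise λ _ → refl

≐-sym : ∀ {f g} → f ≐ g → g ≐ f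
≐-sym f≐g = coeffwise λ n → sym (coeff f≐g n)

≐-trans : ∀ {f g h} → f ≐ g → g ≐ h → f ≐ h
≐-trans f≐g g≐h = coeffwise λ n → trans (coeff f≐g n) (coeff g≐h n)

≐-reflexive : ∀ {f g} → f ≡ g → f ≐ g
≐-reflexive refl = ≐-refl

0ˢ : Series
0ˢ _ = 0ℤ

negate : Series → Series
negate f n = ℤ.- f n

constant : ℤ → Series
constant c = mono c 0

⊕-cong : ∀ {f f′ g g′} → f ≐ f′ → g ≐ g′ → f ⊕ g ≐ f′ ⊕ g′
⊕-cong p q = coeffwise λ n → cong₂ ℤ._+_ (coeff p n) (coeff q n)

⊛-cong : ∀ {f f′ g g′} → f ≐ f′ → g ≐ g′ → f ⊛ g ≐ f′ ⊛ g′
⊛-cong {f} {f′} {g} {g′} p q = coeffwise λ n → begin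
  (f ⊛ g) n                              ≡⟨ ⊛-as-∑ f g n ⟩
  ∑ (suc n) (λ k → f k ℤ.* g (n ∸ k))    ≡⟨ ∑-cong (suc n) (λ k _ → cong₂ ℤ._*_ (coeff p k) (coeff q (n ∸ k))) ⟩
  ∑ (suc n) (λ k → f′ k ℤ.* g′ (n ∸ k))  ≡⟨ ⊛-as-∑ f′ g′ n ⟨
  (f′ ⊛ g′) n                            ∎
  where open ≡-Reasoning

⊛-comm : ∀ f g → f ⊛ g ≐ g ⊛ f
⊛-comm f g = coeffwise λ n → begin
  (f ⊛ g) n                                        ≡⟨ ⊛-as-∑ f g n ⟩
  ∑ (suc n) (λ k → f k ℤ.* g (n ∸ k))              ≡⟨ ∑-reverse (suc n) (λ k → f k ℤ.* g (n ∸ k)) ⟩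
  ∑ (suc n) (λ k → f (n ∸ k) ℤ.* g (n ∸ (n ∸ k)))  ≡⟨ ∑-cong (suc n) (λ k k≤n → swap (ℕₚ.≤-pred k≤n)) ⟩
  ∑ (suc n) (λ k → g k ℤ.* f (n ∸ k))              ≡⟨ ⊛-as-∑ g f n ⟨
  (g ⊛ f) n                                        ∎
  where
  open ≡-Reasoning
  swap : ∀ {k n} → k ≤ n → f (n ∸ k) ℤ.* g (n ∸ (n ∸ k)) ≡ g k ℤ.* f (n ∸ k)
  swap {k} {n} k≤n = trans (ℤₚ.*-comm (f (n ∸ k)) _) (cong (λ i → g i ℤ.* f (n ∸ k)) (ℕₚ.m∸[m∸n]≡n k≤n))

⊛-assoc : ∀ f g h → (f ⊛ g) ⊛ h ≐ f ⊛ (g ⊛ h)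
⊛-assoc f g h = coeffwise coeffAt
  where
  open ≡-Reasoning
  reassociate : ∀ n m k → k ≤ m → m ≤ n →
    h (n ∸ m) ℤ.* (f k ℤ.* g (m ∸ k)) ≡ f k ℤ.* (g (m ∸ k) ℤ.* h (n ∸ k ∸ (m ∸ k)))
  reassociate n m k k≤m m≤n rewrite ℕₚ.∸-+-assoc n k (m ∸ k) | ℕₚ.m+[n∸m]≡n k≤m =
    trans (ℤₚ.*-comm (h (n ∸ m)) _) (ℤₚ.*-assoc (f k) (g (m ∸ k)) (h (n ∸ m)))
  expandLeft : ∀ n m → m ≤ n →
    (f ⊛ g) m ℤ.* h (n ∸ m) ≡ ∑ (suc m) (λ k → f k ℤ.* (g (m ∸ k) ℤ.* h (n ∸ k ∸ (m ∸ k))))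
  expandLeft n m m≤n = begin
    (f ⊛ g) m ℤ.* h (n ∸ m)                            ≡⟨ cong (ℤ._* h (n ∸ m)) (⊛-as-∑ f g m) ⟩
    ∑ (suc m) (λ k → f k ℤ.* g (m ∸ k)) ℤ.* h (n ∸ m)  ≡⟨ ℤₚ.*-comm _ (h (n ∸ m)) ⟩
    h (n ∸ m) ℤ.* ∑ (suc m) (λ k → f k ℤ.* g (m ∸ k))  ≡⟨ *-∑ (suc m) (h (n ∸ m)) (λ k → f k ℤ.* g (m ∸ k)) ⟩
    ∑ (suc m) (λ k → h (n ∸ m) ℤ.* (f k ℤ.* g (m ∸ k)))
      ≡⟨ ∑-cong (suc m) (λ k k≤m → reassociate n m k (ℕₚ.≤-pred k≤m) m≤n) ⟩
    ∑ (suc m) (λ k → f k ℤ.* (g (m ∸ k) ℤ.* h (n ∸ k ∸ (m ∸ k)))) ∎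
  coeffAt : ∀ n → ((f ⊛ g) ⊛ h) n ≡ (f ⊛ (g ⊛ h)) n
  coeffAt n = begin
    ((f ⊛ g) ⊛ h) n
      ≡⟨ ⊛-as-∑ (f ⊛ g) h n ⟩
    ∑ (suc n) (λ m → (f ⊛ g) m ℤ.* h (n ∸ m))
      ≡⟨ ∑-cong (suc n) (λ m m≤n → expandLeft n m (ℕₚ.≤-pred m≤n)) ⟩
    ∑ (suc n) (λ m → ∑ (suc m) (λ k → f k ℤ.* (g (m ∸ k) ℤ.* h (n ∸ k ∸ (m ∸ k)))))
      ≡⟨ ∑-triangle n (λ k j → f k ℤ.* (g j ℤ.* h (n ∸ k ∸ j))) ⟨
    ∑ (suc n) (λ k → ∑ (suc (n ∸ k)) (λ j → f k ℤ.* (g j ℤ.* h (n ∸ k ∸ j))))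
      ≡⟨ ∑-cong (suc n) (λ k _ → trans (sym (*-∑ (suc (n ∸ k)) (f k) (λ j → g j ℤ.* h (n ∸ k ∸ j))))
                                       (cong (ℤ._*_ (f k)) (sym (⊛-as-∑ g h (n ∸ k))))) ⟩
    ∑ (suc n) (λ k → f k ℤ.* (g ⊛ h) (n ∸ k))
      ≡⟨ ⊛-as-∑ f (g ⊛ h) n ⟨
    (f ⊛ (g ⊛ h)) n ∎

⊛-distribˡ-⊕ : ∀ f g h → f ⊛ (g ⊕ h) ≐ f ⊛ g ⊕ f ⊛ h
⊛-distribˡ-⊕ f g h = coeffwise λ n → begin
  (f ⊛ (g ⊕ h)) n                                                        ≡⟨ ⊛-as-∑ f (g ⊕ h) n ⟩
  ∑ (suc n) (λ k → f k ℤ.* (g (n ∸ k) ℤ.+ h (n ∸ k)))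
    ≡⟨ ∑-cong (suc n) (λ k _ → ℤₚ.*-distribˡ-+ (f k) (g (n ∸ k)) (h (n ∸ k))) ⟩
  ∑ (suc n) (λ k → f k ℤ.* g (n ∸ k) ℤ.+ f k ℤ.* h (n ∸ k))
    ≡⟨ ∑-+ (suc n) (λ k → f k ℤ.* g (n ∸ k)) (λ k → f k ℤ.* h (n ∸ k)) ⟩
  ∑ (suc n) (λ k → f k ℤ.* g (n ∸ k)) ℤ.+ ∑ (suc n) (λ k → f k ℤ.* h (n ∸ k))  ≡⟨ cong₂ ℤ._+_ (⊛-as-∑ f g n) (⊛-as-∑ f h n) ⟨
  (f ⊛ g ⊕ f ⊛ h) n                                                            ∎
  where open ≡-Reasoning

constant-⊛ : ∀ c f n → (constant c ⊛ f) n ≡ c ℤ.* f n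
constant-⊛ c f n = begin
  (constant c ⊛ f) n                              ≡⟨ ⊛-as-∑ (constant c) f n ⟩
  c ℤ.* f n ℤ.+ ∑ n (λ k → 0ℤ ℤ.* f (n ∸ suc k))  ≡⟨ cong (ℤ._+_ (c ℤ.* f n)) (∑-zero n (λ k _ → ℤₚ.*-zeroˡ (f (n ∸ suc k)))) ⟩
  c ℤ.* f n ℤ.+ 0ℤ                                ≡⟨ ℤₚ.+-identityʳ (c ℤ.* f n) ⟩
  c ℤ.* f n                                       ∎
  where open ≡-Reasoning

one-⊛ : ∀ f → one ⊛ f ≐ f
one-⊛ f = coeffwise λ n → trans (constant-⊛ 1ℤ f n) (ℤₚ.*-identityˡ (f n))

⊕-⊛-isCommutativeRing : IsCommutativeRing _≐_ _⊕_ _⊛_ negate 0ˢ one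
⊕-⊛-isCommutativeRing = record
  { isRing = record
    { +-isAbelianGroup = record
      { isGroup = record
        { isMonoid = record
          { isSemigroup = record
            { isMagma = record
              { isEquivalence = record { refl = ≐-refl ; sym = ≐-sym ; trans = ≐-trans }
              ; ∙-cong = ⊕-cong }
            ; assoc = λ f g h → coeffwise λ n → ℤₚ.+-assoc (f n) (g n) (h n) }
          ; identity = (λ f → coeffwise λ n → ℤₚ.+-identityˡ (f n))
                     , (λ f → coeffwise λ n → ℤₚ.+-identityʳ (f n)) }
        ; inverse = (λ f → coeffwise λ n → ℤₚ.+-inverseˡ (f n))
                  , (λ f → coeffwise λ n → ℤₚ.+-inverseʳ (f n))
        ; ⁻¹-cong = λ p → coeffwise λ n → cong ℤ.-_ (coeff p n) }
      ; comm = λ f g → coeffwise λ n → ℤₚ.+-comm (f n) (g n) }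
    ; *-cong = ⊛-cong
    ; *-assoc = ⊛-assoc
    ; *-identity = one-⊛ , λ f → ≐-trans (⊛-comm f one) (one-⊛ f)
    ; distrib = ⊛-distribˡ-⊕
              , λ f g h → ≐-trans (⊛-comm (g ⊕ h) f)
                            (≐-trans (⊛-distribˡ-⊕ f g h) (⊕-cong (⊛-comm f g) (⊛-comm f h))) }
  ; *-comm = ⊛-comm }

-- Algebra.Solver.Ring compares normal forms by conversion; keeping the ring operations opaque
-- stops Agda from unfolding the Cauchy product while it does so.
opaque
  infixl 7 _⊗_
  infixl 6 _⊞_
  infix  8 ⊟_
  _⊗_ : Series → Series → Series
  _⊗_ = _⊛_
  _⊞_ : Series → Series → Series
  _⊞_ = _⊕_
  ⊟_ : Series → Series
  ⊟_ = negate

opaque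
  unfolding _⊗_
  ⊗-coeff : ∀ f g n → (f ⊗ g) n ≡ (f ⊛ g) n
  ⊗-coeff f g n = refl
  ⊞-coeff : ∀ f g n → (f ⊞ g) n ≡ f n ℤ.+ g n
  ⊞-coeff f g n = refl
  ⊟-coeff : ∀ f n → (⊟ f) n ≡ ℤ.- f n
  ⊟-coeff f n = refl
  ⊞-⊗-isCommutativeRing : IsCommutativeRing _≐_ _⊞_ _⊗_ ⊟_ 0ˢ one
  ⊞-⊗-isCommutativeRing = ⊕-⊛-isCommutativeRing
  constant-+ : ∀ a b → constant (a ℤ.+ b) ≐ constant a ⊞ constant b
  constant-+ a b = coeffwise λ { zero → refl ; (suc n) → refl }
  constant-* : ∀ a b → constant (a ℤ.* b) ≐ constant a ⊗ constant b
  constant-* a b = coeffwise λ n → sym (trans (constant-⊛ a (constant b) n) (scale n))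
    where
    scale : ∀ n → a ℤ.* constant b n ≡ constant (a ℤ.* b) n
    scale zero    = refl
    scale (suc n) = ℤₚ.*-zeroʳ a
  constant-neg : ∀ a → constant (ℤ.- a) ≐ ⊟ constant a
  constant-neg a = coeffwise λ { zero → refl ; (suc n) → refl }

seriesRing : CommutativeRing _ _
seriesRing = record { isCommutativeRing = ⊞-⊗-isCommutativeRing }

open CommutativeRing seriesRing
  using ()
  renaming ( +-cong to ⊞-cong ; -‿cong to ⊟-cong ; +-congˡ to ⊞-congˡ ; +-congʳ to ⊞-congʳ ; +-assoc to ⊞-assoc ; +-comm to ⊞-comm
           ; +-identityˡ to ⊞-identityˡ ; +-identityʳ to ⊞-identityʳ
           ; *-cong to ⊗-cong ; *-congˡ to ⊗-congˡ ; *-congʳ to ⊗-congʳ ; *-assoc to ⊗-assoc ; *-comm to ⊗-comm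
           ; *-identityˡ to ⊗-identityˡ ; *-identityʳ to ⊗-identityʳ ; zeroˡ to ⊗-zeroˡ ; zeroʳ to ⊗-zeroʳ
           ; distribˡ to ⊗-distribˡ-⊞ )

module ≐-Reasoning = Relation.Binary.Reasoning.Setoid (CommutativeRing.setoid seriesRing)

open CommutativeSemigroupProperties (CommutativeRing.*-commutativeSemigroup seriesRing) using (x∙yz≈y∙xz)

constant-homomorphism : ACR._-Raw-AlmostCommutative⟶_ ℤ.+-*-rawRing (ACR.fromCommutativeRing seriesRing)
constant-homomorphism = record
  { ⟦_⟧    = constant
  ; +-homo = constant-+
  ; *-homo = constant-*
  ; -‿homo = constant-neg
  ; 0-homo = coeffwise λ { zero → refl ; (suc n) → refl }
  ; 1-homo = ≐-refl }

constant-≟ : ∀ a b → Maybe (constant a ≐ constant b)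
constant-≟ a b with a ℤ.≟ b
... | yes refl = just ≐-refl
... | no _     = nothing

open Algebra.Solver.Ring ℤ.+-*-rawRing (ACR.fromCommutativeRing seriesRing) constant-homomorphism constant-≟
  using (solve; _:=_; _:+_; _:*_; _:-_; con)

open FiniteSum seriesRing
  using ()
  renaming ( ∑ to ∑ˢ ; ∑-cong to ∑ˢ-cong ; ∑-zero to ∑ˢ-zero ; ∑-+ to ∑ˢ-+ ; *-∑ to ⊗-∑ˢ ; ∑-* to ∑ˢ-⊗
           ; ∑-last to ∑ˢ-last ; ∑-vanishing-tail to ∑ˢ-vanishing-tail ; ∑-single to ∑ˢ-single )

∑ˢ-pad : ∀ L n (f : ℕ → Series) → n ≤ L → (∀ i → n ≤ i → f i ≐ 0ˢ) → ∑ˢ L f ≐ ∑ˢ n f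
∑ˢ-pad L n f n≤L tail = subst (λ L → ∑ˢ L f ≐ ∑ˢ n f) (ℕₚ.m+[n∸m]≡n n≤L) (∑ˢ-vanishing-tail n (L ∸ n) f tail)

⊗-coeff₀ : ∀ f g → (f ⊗ g) 0 ≡ f 0 ℤ.* g 0
⊗-coeff₀ f g = trans (⊗-coeff f g 0) (ℤₚ.+-identityʳ (f 0 ℤ.* g 0))

⊛-as-⊗ : ∀ f g → f ⊛ g ≐ f ⊗ g
⊛-as-⊗ f g = coeffwise λ n → sym (⊗-coeff f g n)

⊕-as-⊞ : ∀ f g → f ⊕ g ≐ f ⊞ g
⊕-as-⊞ f g = coeffwise λ n → sym (⊞-coeff f g n)

infix 8 1-_
1-_ : Series → Series
1- f = one ⊞ ⊟ f

1-‿cong : ∀ {f g} → f ≐ g → 1- f ≐ 1- g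
1-‿cong f≐g = ⊞-congˡ (⊟-cong f≐g)

⊗-distrib₃-cong : ∀ {u v a b c a′ b′ c′} → u ⊗ a ≐ v ⊗ a′ → u ⊗ b ≐ v ⊗ b′ → u ⊗ c ≐ v ⊗ c′ →
  u ⊗ (a ⊞ b ⊞ c) ≐ v ⊗ (a′ ⊞ b′ ⊞ c′)
⊗-distrib₃-cong {u} {v} {a} {b} {c} {a′} {b′} {c′} ea eb ec = begin
  u ⊗ (a ⊞ b ⊞ c)           ≈⟨ ≐-trans (⊗-distribˡ-⊞ u _ c) (⊞-congʳ (⊗-distribˡ-⊞ u a b)) ⟩
  u ⊗ a ⊞ u ⊗ b ⊞ u ⊗ c     ≈⟨ ⊞-cong (⊞-cong ea eb) ec ⟩
  v ⊗ a′ ⊞ v ⊗ b′ ⊞ v ⊗ c′  ≈⟨ ≐-sym (≐-trans (⊗-distribˡ-⊞ v _ c′) (⊞-congʳ (⊗-distribˡ-⊞ v a′ b′))) ⟩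
  v ⊗ (a′ ⊞ b′ ⊞ c′)        ∎
  where open ≐-Reasoning

⊗-zero-both : ∀ u v w x → u ⊗ (w ⊗ 0ˢ) ≐ v ⊗ (x ⊗ 0ˢ)
⊗-zero-both u v w x = ≐-trans (⊗-congˡ (⊗-zeroʳ w)) (≐-trans (⊗-zeroʳ u) (≐-sym (≐-trans (⊗-congˡ (⊗-zeroʳ x)) (⊗-zeroʳ v))))

infix 9 q^_
q^_ : ℕ → Series
q^ a = mono 1ℤ a

mono-≢ : ∀ c a n → n ≢ a → mono c a n ≡ 0ℤ
mono-≢ c zero    zero    n≢a = ⊥-elim (n≢a refl)
mono-≢ c zero    (suc n) n≢a = refl
mono-≢ c (suc a) zero    n≢a = refl
mono-≢ c (suc a) (suc n) n≢a = mono-≢ c a n (n≢a ∘ cong suc)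

mono-self : ∀ c a → mono c a a ≡ c
mono-self c zero    = refl
mono-self c (suc a) = mono-self c a

mono-+ : ∀ c a b m → mono c (a + b) (a + m) ≡ mono c b m
mono-+ c zero    b m = refl
mono-+ c (suc a) b m = mono-+ c a b m

mono-neg : ∀ a → mono -1ℤ a ≐ ⊟ q^ a
mono-neg a = coeffwise λ n → sym (trans (⊟-coeff (q^ a) n) (negate-indicator n))
  where
  negate-indicator : ∀ n → ℤ.- mono 1ℤ a n ≡ mono -1ℤ a n
  negate-indicator n with n ℕ.≡ᵇ a
  ... | true  = refl
  ... | false = refl

data Offset (a : ℕ) : ℕ → Set where
  below : ∀ {n} → n < a → Offset a n
  above : ∀ m → Offset a (a + m)

offset : ∀ a n → Offset a n
offset zero    n       = above n
offset (suc a) zero    = below (s≤s z≤n)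
offset (suc a) (suc n) with offset a n
... | below n<a = below (s≤s n<a)
... | above m   = above m

q^-⊗-below : ∀ a f n → n < a → (q^ a ⊗ f) n ≡ 0ℤ
q^-⊗-below a f n n<a = trans (⊗-coeff (q^ a) f n) (trans (⊛-as-∑ (q^ a) f n) (∑-zero (suc n) vanish))
  where
  vanish : ∀ k → k < suc n → (q^ a) k ℤ.* f (n ∸ k) ≡ 0ℤ
  vanish k k≤n = trans (cong (ℤ._* f (n ∸ k)) (mono-≢ 1ℤ a k (ℕₚ.<⇒≢ (ℕₚ.≤-<-trans (ℕₚ.≤-pred k≤n) n<a))))
                       (ℤₚ.*-zeroˡ (f (n ∸ k)))

q^-⊗-above : ∀ a f m → (q^ a ⊗ f) (a + m) ≡ f m
q^-⊗-above a f m = begin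
  (q^ a ⊗ f) (a + m)  ≡⟨ ⊗-coeff (q^ a) f (a + m) ⟩
  (q^ a ⊛ f) (a + m)  ≡⟨ ⊛-as-∑ (q^ a) f (a + m) ⟩
  ∑ (suc (a + m)) (λ k → (q^ a) k ℤ.* f (a + m ∸ k))
    ≡⟨ ∑-single (suc (a + m)) a _ (s≤s (ℕₚ.m≤m+n a m)) (λ k _ k≢a → cong (ℤ._* f (a + m ∸ k)) (mono-≢ 1ℤ a k k≢a)) ⟩
  (q^ a) a ℤ.* f (a + m ∸ a)  ≡⟨ cong₂ ℤ._*_ (mono-self 1ℤ a) (cong f (ℕₚ.m+n∸m≡n a m)) ⟩
  1ℤ ℤ.* f m                  ≡⟨ ℤₚ.*-identityˡ (f m) ⟩
  f m                         ∎
  where open ≡-Reasoning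

q^-⊗-characterisation : ∀ a f g → (∀ n → n < a → g n ≡ 0ℤ) → (∀ m → g (a + m) ≡ f m) → q^ a ⊗ f ≐ g
q^-⊗-characterisation a f g low high = coeffwise coeffAt
  where
  coeffAt : ∀ n → (q^ a ⊗ f) n ≡ g n
  coeffAt n with offset a n
  ... | below n<a = trans (q^-⊗-below a f n n<a) (sym (low n n<a))
  ... | above m   = trans (q^-⊗-above a f m) (sym (high m))

q^-+ : ∀ a b → q^ (a + b) ≐ q^ a ⊗ q^ b
q^-+ a b = ≐-sym (q^-⊗-characterisation a (q^ b) (q^ (a + b))
  (λ n n<a → mono-≢ 1ℤ (a + b) n (λ n≡a+b → ℕₚ.<⇒≱ n<a (subst (a ≤_) (sym n≡a+b) (ℕₚ.m≤m+n a b))))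
  (mono-+ 1ℤ a b))

q^-⊗-q^ : ∀ a b x → q^ a ⊗ (q^ b ⊗ x) ≐ q^ (a + b) ⊗ x
q^-⊗-q^ a b x = ≐-trans (≐-sym (⊗-assoc (q^ a) (q^ b) x)) (⊗-congʳ (≐-sym (q^-+ a b)))

q^-exponent : ∀ {a b} → a ≡ b → q^ a ≐ q^ b
q^-exponent a≡b = ≐-reflexive (cong q^_ a≡b)

q^-rebalance : ∀ {a b c d} x → a + b ≡ c + d → q^ a ⊗ (q^ b ⊗ x) ≐ q^ c ⊗ (q^ d ⊗ x)
q^-rebalance {a} {b} {c} {d} x eq =
  ≐-trans (q^-⊗-q^ a b x) (≐-trans (⊗-congʳ (q^-exponent eq)) (≐-sym (q^-⊗-q^ c d x)))

q^-split : ∀ {a b c} x → a ≡ b + c → q^ a ⊗ x ≐ q^ b ⊗ (q^ c ⊗ x)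
q^-split {a} {b} {c} x eq = ≐-trans (⊗-congʳ (q^-exponent eq)) (≐-sym (q^-⊗-q^ b c x))

q^-scaled-+ : ∀ a b s → q^ ((a + b) * s) ≐ q^ (a * s) ⊗ q^ (b * s)
q^-scaled-+ a b s = ≐-trans (q^-exponent (ℕₚ.*-distribʳ-+ s a b)) (q^-+ (a * s) (b * s))

q^-⊗-cancel : ∀ a {x y} → q^ a ⊗ x ≐ q^ a ⊗ y → x ≐ y
q^-⊗-cancel a {x} {y} eq = coeffwise λ m → trans (sym (q^-⊗-above a x m)) (trans (coeff eq (a + m)) (q^-⊗-above a y m))

-- Agreement below a given degree

infix 4 _≈[_]_
record _≈[_]_ (f : Series) (p : ℕ) (g : Series) : Set where
  constructor agreeBelow
  field agree : ∀ n → n < p → f n ≡ g n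
open _≈[_]_

≈-refl : ∀ {f p} → f ≈[ p ] f
≈-refl = agreeBelow λ _ _ → refl

≈-sym : ∀ {f g p} → f ≈[ p ] g → g ≈[ p ] f
≈-sym f≈g = agreeBelow λ n n<p → sym (agree f≈g n n<p)

≈-trans : ∀ {f g h p} → f ≈[ p ] g → g ≈[ p ] h → f ≈[ p ] h
≈-trans f≈g g≈h = agreeBelow λ n n<p → trans (agree f≈g n n<p) (agree g≈h n n<p)

≐⇒≈ : ∀ {f g p} → f ≐ g → f ≈[ p ] g
≐⇒≈ f≐g = agreeBelow λ n _ → coeff f≐g n

≈-weaken : ∀ {f g p q} → q ≤ p → f ≈[ p ] g → f ≈[ q ] g
≈-weaken q≤p f≈g = agreeBelow λ n n<q → agree f≈g n (ℕₚ.<-≤-trans n<q q≤p)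

≈-setoid : ℕ → Setoid _ _
≈-setoid p = record
  { Carrier = Series ; _≈_ = _≈[ p ]_
  ; isEquivalence = record { refl = ≈-refl ; sym = ≈-sym ; trans = ≈-trans } }

module ≈-Reasoning (p : ℕ) where
  open Relation.Binary.Reasoning.Setoid (≈-setoid p) public
  infixr 2 _≐⟨_⟩_
  _≐⟨_⟩_ : ∀ f {g h} → f ≐ g → g IsRelatedTo h → f IsRelatedTo h
  f ≐⟨ f≐g ⟩ g≈h = f ≈⟨ ≐⇒≈ f≐g ⟩ g≈h

⊞-cong≈ : ∀ {f f′ g g′ p} → f ≈[ p ] f′ → g ≈[ p ] g′ → f ⊞ g ≈[ p ] f′ ⊞ g′
⊞-cong≈ {f} {f′} {g} {g′} f≈f′ g≈g′ = agreeBelow λ n n<p →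
  trans (⊞-coeff f g n) (trans (cong₂ ℤ._+_ (agree f≈f′ n n<p) (agree g≈g′ n n<p)) (sym (⊞-coeff f′ g′ n)))

⊗-cong≈ : ∀ {f f′ g g′ p} → f ≈[ p ] f′ → g ≈[ p ] g′ → f ⊗ g ≈[ p ] f′ ⊗ g′
⊗-cong≈ {f} {f′} {g} {g′} f≈f′ g≈g′ = agreeBelow λ n n<p → begin
  (f ⊗ g) n                            ≡⟨ trans (⊗-coeff f g n) (⊛-as-∑ f g n) ⟩
  ∑ (suc n) (λ k → f k ℤ.* g (n ∸ k))
    ≡⟨ ∑-cong (suc n) (λ k k≤n → cong₂ ℤ._*_ (agree f≈f′ k (ℕₚ.≤-<-trans (ℕₚ.≤-pred k≤n) n<p))
                                            (agree g≈g′ (n ∸ k) (ℕₚ.≤-<-trans (ℕₚ.m∸n≤m n k) n<p))) ⟩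
  ∑ (suc n) (λ k → f′ k ℤ.* g′ (n ∸ k))  ≡⟨ trans (⊗-coeff f′ g′ n) (⊛-as-∑ f′ g′ n) ⟨
  (f′ ⊗ g′) n                            ∎
  where open ≡-Reasoning

∑ˢ-cong≈ : ∀ n {f g p} → (∀ i → i < n → f i ≈[ p ] g i) → ∑ˢ n f ≈[ p ] ∑ˢ n g
∑ˢ-cong≈ zero    f≈g = ≈-refl
∑ˢ-cong≈ (suc n) f≈g = ⊞-cong≈ (f≈g 0 (s≤s z≤n)) (∑ˢ-cong≈ n (λ i i<n → f≈g (suc i) (s≤s i<n)))

q^-⊗-cong≈ : ∀ a {f g p} → f ≈[ p ] g → q^ a ⊗ f ≈[ a + p ] q^ a ⊗ g
q^-⊗-cong≈ a {f} {g} {p} f≈g = agreeBelow coeffAt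
  where
  coeffAt : ∀ n → n < a + p → (q^ a ⊗ f) n ≡ (q^ a ⊗ g) n
  coeffAt n n<a+p with offset a n
  ... | below n<a = trans (q^-⊗-below a f n n<a) (sym (q^-⊗-below a g n n<a))
  ... | above m   = trans (q^-⊗-above a f m)
                      (trans (agree f≈g m (ℕₚ.+-cancelˡ-< a m p n<a+p)) (sym (q^-⊗-above a g m)))

q^-≈0 : ∀ a {p} → p ≤ a → q^ a ≈[ p ] 0ˢ
q^-≈0 a p≤a = agreeBelow λ n n<p → mono-≢ 1ℤ a n (ℕₚ.<⇒≢ (ℕₚ.<-≤-trans n<p p≤a))

⊞-≈0 : ∀ f {g p} → g ≈[ p ] 0ˢ → f ⊞ g ≈[ p ] f
⊞-≈0 f {g} g≈0 = agreeBelow λ n n<p →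
  trans (⊞-coeff f g n) (trans (cong (ℤ._+_ (f n)) (agree g≈0 n n<p)) (ℤₚ.+-identityʳ (f n)))

⊟-≈0 : ∀ {g p} → g ≈[ p ] 0ˢ → ⊟ g ≈[ p ] 0ˢ
⊟-≈0 {g} g≈0 = agreeBelow λ n n<p → trans (⊟-coeff g n) (cong ℤ.-_ (agree g≈0 n n<p))

unit-⊗-cancel≈ : ∀ E {x y p} → E 0 ≡ 1ℤ → E ⊗ x ≈[ p ] E ⊗ y → x ≈[ p ] y
unit-⊗-cancel≈ E {x} {y} {p} E₀≡1 Ex≈Ey = agreeBelow (<-rec (λ n → n < p → x n ≡ y n) step)
  where
  expand : ∀ z n → (E ⊗ z) n ≡ z n ℤ.+ ∑ n (λ k → E (suc k) ℤ.* z (n ∸ suc k))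
  expand z n = trans (⊗-coeff E z n) (trans (⊛-as-∑ E z n)
    (cong (ℤ._+ ∑ n (λ k → E (suc k) ℤ.* z (n ∸ suc k))) (trans (cong (ℤ._* z n) E₀≡1) (ℤₚ.*-identityˡ (z n)))))
  step : ∀ n → (∀ {m} → m < n → m < p → x m ≡ y m) → n < p → x n ≡ y n
  step n earlier n<p = ∙-cancelʳ _ (x n) (y n) (begin
    x n ℤ.+ ∑ n (λ k → E (suc k) ℤ.* x (n ∸ suc k))  ≡⟨ expand x n ⟨
    (E ⊗ x) n                                        ≡⟨ agree Ex≈Ey n n<p ⟩
    (E ⊗ y) n                                        ≡⟨ expand y n ⟩
    y n ℤ.+ ∑ n (λ k → E (suc k) ℤ.* y (n ∸ suc k))
      ≡⟨ cong (ℤ._+_ (y n)) (∑-cong n (λ k k<n → cong (ℤ._*_ (E (suc k))) (sym (previous k k<n)))) ⟩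
    y n ℤ.+ ∑ n (λ k → E (suc k) ℤ.* x (n ∸ suc k))  ∎)
    where
    open ≡-Reasoning
    previous : ∀ k → k < n → x (n ∸ suc k) ≡ y (n ∸ suc k)
    previous k k<n = earlier (ℕₚ.∸-monoʳ-< (s≤s z≤n) k<n) (ℕₚ.≤-<-trans (ℕₚ.m∸n≤m n (suc k)) n<p)

poch : ℕ → ℕ → Series
poch s zero    = one
poch s (suc k) = poch s k ⊗ (1- q^ (suc k * s))

1-q^-≈one : ∀ a {p} → p ≤ a → 1- q^ a ≈[ p ] one
1-q^-≈one a p≤a = ⊞-≈0 one (⊟-≈0 (q^-≈0 a p≤a))

1+q^-≈one : ∀ a {p} → p ≤ a → one ⊞ q^ a ≈[ p ] one
1+q^-≈one a p≤a = ⊞-≈0 one (q^-≈0 a p≤a)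

poch-constant-term : ∀ s k → poch (suc s) k 0 ≡ 1ℤ
poch-constant-term s zero    = refl
poch-constant-term s (suc k) = begin
  poch (suc s) (suc k) 0                          ≡⟨ ⊗-coeff₀ (poch (suc s) k) _ ⟩
  poch (suc s) k 0 ℤ.* (1- q^ (suc k * suc s)) 0  ≡⟨ cong₂ ℤ._*_ (poch-constant-term s k) (agree (1-q^-≈one _ (s≤s z≤n)) 0 (s≤s z≤n)) ⟩
  1ℤ                                              ∎
  where open ≡-Reasoning

poch-truncation : ∀ s {k K} → k ≤ K → poch s K ≈[ suc k * s ] poch s k
poch-truncation s {k} k≤K = subst (λ K → poch s K ≈[ suc k * s ] poch s k) (ℕₚ.m∸n+n≡m k≤K) (extend (_ ∸ k))
  where
  extend : ∀ d → poch s (d + k) ≈[ suc k * s ] poch s k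
  extend zero    = ≈-refl
  extend (suc d) = ≈-trans (⊗-cong≈ (extend d) (1-q^-≈one _ (ℕₚ.*-monoˡ-≤ s (s≤s (ℕₚ.m≤n+m k d)))))
                           (≐⇒≈ (⊗-identityʳ (poch s k)))

-- Elementary symmetric functions of q^(a s), …, q^((a + n − 1) s)

choose₂ : ℕ → ℕ
choose₂ zero    = zero
choose₂ (suc n) = choose₂ n + n

esym : ℕ → ℕ → ℕ → ℕ → Series
esym s a zero    zero    = one
esym s a zero    (suc j) = 0ˢ
esym s a (suc n) zero    = one
esym s a (suc n) (suc j) = esym s a n (suc j) ⊞ q^ ((a + n) * s) ⊗ esym s a n j

esym-zero : ∀ s a n → esym s a n 0 ≐ one
esym-zero s a zero    = ≐-refl
esym-zero s a (suc n) = ≐-refl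

esym-empty : ∀ s a b j → esym s a 0 j ≡ esym s b 0 j
esym-empty s a b zero    = refl
esym-empty s a b (suc j) = refl

esym-vanishes : ∀ s a {n j} → n < j → esym s a n j ≐ 0ˢ
esym-vanishes s a {zero}  {suc j} _         = ≐-refl
esym-vanishes s a {suc n} {suc j} (s≤s n<j) = begin
  esym s a n (suc j) ⊞ q^ ((a + n) * s) ⊗ esym s a n j  ≈⟨ ⊞-cong (esym-vanishes s a (ℕₚ.m<n⇒m<1+n n<j)) (⊗-congˡ (esym-vanishes s a n<j)) ⟩
  0ˢ ⊞ q^ ((a + n) * s) ⊗ 0ˢ                            ≈⟨ ≐-trans (⊞-identityˡ _) (⊗-zeroʳ _) ⟩
  0ˢ                                                    ∎
  where open ≐-Reasoning

esym-diagonal : ∀ s n → esym s 0 n n ≐ q^ (choose₂ n * s)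
esym-diagonal s zero    = ≐-refl
esym-diagonal s (suc n) = begin
  esym s 0 n (suc n) ⊞ q^ (n * s) ⊗ esym s 0 n n  ≈⟨ ⊞-cong (esym-vanishes s 0 {n} ℕₚ.≤-refl) (⊗-congˡ (esym-diagonal s n)) ⟩
  0ˢ ⊞ q^ (n * s) ⊗ q^ (choose₂ n * s)            ≈⟨ ⊞-identityˡ _ ⟩
  q^ (n * s) ⊗ q^ (choose₂ n * s)                 ≈⟨ ≐-sym (q^-+ (n * s) (choose₂ n * s)) ⟩
  q^ (n * s + choose₂ n * s)                      ≈⟨ q^-exponent (trans (ℕₚ.+-comm (n * s) _) (sym (ℕₚ.*-distribʳ-+ s (choose₂ n) n))) ⟩
  q^ (choose₂ (suc n) * s)                        ∎
  where open ≐-Reasoning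

esym-front : ∀ s a n j → esym s a (suc n) (suc j) ≐ q^ (a * s) ⊗ esym s (suc a) n j ⊞ esym s (suc a) n (suc j)
esym-front s a zero j = begin
  0ˢ ⊞ q^ ((a + 0) * s) ⊗ esym s a 0 j  ≈⟨ ⊞-comm _ _ ⟩
  q^ ((a + 0) * s) ⊗ esym s a 0 j ⊞ 0ˢ  ≈⟨ ⊞-congʳ (⊗-cong (q^-exponent (cong (_* s) (ℕₚ.+-identityʳ a))) (≐-reflexive (esym-empty s a (suc a) j))) ⟩
  q^ (a * s) ⊗ esym s (suc a) 0 j ⊞ 0ˢ  ∎
  where open ≐-Reasoning
esym-front s a (suc n) zero = begin
  esym s a (suc n) 1 ⊞ q^ ((a + suc n) * s) ⊗ one
    ≈⟨ ⊞-cong (esym-front s a n 0) (⊗-cong (q^-exponent (cong (_* s) (ℕₚ.+-suc a n))) (≐-sym (esym-zero s (suc a) n))) ⟩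
  (q^ (a * s) ⊗ esym s (suc a) n 0 ⊞ esym s (suc a) n 1) ⊞ q^ ((suc a + n) * s) ⊗ esym s (suc a) n 0
    ≈⟨ ≐-trans (⊞-assoc _ _ _) (⊞-congʳ (⊗-congˡ (esym-zero s (suc a) n))) ⟩
  q^ (a * s) ⊗ one ⊞ esym s (suc a) (suc n) 1 ∎
  where open ≐-Reasoning
esym-front s a (suc n) (suc j) = begin
  esym s a (suc n) (suc (suc j)) ⊞ q^ ((a + suc n) * s) ⊗ esym s a (suc n) (suc j)
    ≈⟨ ⊞-cong (esym-front s a n (suc j)) (⊗-cong (q^-exponent (cong (_* s) (ℕₚ.+-suc a n))) (esym-front s a n j)) ⟩
  (u ⊗ e₁ ⊞ e₂) ⊞ m ⊗ (u ⊗ e₀ ⊞ e₁)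
    ≈⟨ solve 5 (λ u m e₀ e₁ e₂ → (u :* e₁ :+ e₂) :+ m :* (u :* e₀ :+ e₁) := u :* (e₁ :+ m :* e₀) :+ (e₂ :+ m :* e₁))
               ≐-refl u m e₀ e₁ e₂ ⟩
  u ⊗ (e₁ ⊞ m ⊗ e₀) ⊞ (e₂ ⊞ m ⊗ e₁) ∎
  where
  open ≐-Reasoning
  u  = q^ (a * s)
  m  = q^ ((suc a + n) * s)
  e₀ = esym s (suc a) n j
  e₁ = esym s (suc a) n (suc j)
  e₂ = esym s (suc a) n (suc (suc j))

esym-homogeneous : ∀ s a n j → esym s (suc a) n j ≐ q^ (j * s) ⊗ esym s a n j
esym-homogeneous s a zero    zero    = ≐-sym (⊗-identityˡ one)
esym-homogeneous s a zero    (suc j) = ≐-sym (⊗-zeroʳ _)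
esym-homogeneous s a (suc n) zero    = ≐-sym (⊗-identityˡ one)
esym-homogeneous s a (suc n) (suc j) = begin
  esym s (suc a) n (suc j) ⊞ q^ ((suc a + n) * s) ⊗ esym s (suc a) n j
    ≈⟨ ⊞-cong (esym-homogeneous s a n (suc j)) (⊗-congˡ (esym-homogeneous s a n j)) ⟩
  q^ (suc j * s) ⊗ esym s a n (suc j) ⊞ q^ ((suc a + n) * s) ⊗ (q^ (j * s) ⊗ esym s a n j)
    ≈⟨ ⊞-congˡ (q^-rebalance _ exponents) ⟩
  q^ (suc j * s) ⊗ esym s a n (suc j) ⊞ q^ (suc j * s) ⊗ (q^ ((a + n) * s) ⊗ esym s a n j)
    ≈⟨ ≐-sym (⊗-distribˡ-⊞ _ _ _) ⟩
  q^ (suc j * s) ⊗ esym s a (suc n) (suc j) ∎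
  where
  open ≐-Reasoning
  exponents : (suc a + n) * s + j * s ≡ suc j * s + (a + n) * s
  exponents = ℕ-Ring.solve (s ∷ a ∷ n ∷ j ∷ [])

-- The identity behind it: (1 − Q L) + Q L (1 − Q Y) = 1 − Q Y · Q L.
pascal-product-step : ∀ A₁ A₀ Pj Pl Pm U Y L Q →
  A₁ ⊗ (Pj ⊗ 1- (Q ⊗ Y)) ⊗ Pl ≐ U ⊗ Y ⊗ Pm →
  A₀ ⊗ Pj ⊗ (Pl ⊗ 1- (Q ⊗ L)) ≐ U ⊗ Pm →
  (A₁ ⊞ Y ⊗ (Q ⊗ L) ⊗ A₀) ⊗ (Pj ⊗ 1- (Q ⊗ Y)) ⊗ (Pl ⊗ 1- (Q ⊗ L)) ≐ U ⊗ Y ⊗ (Pm ⊗ 1- (Q ⊗ (Y ⊗ (Q ⊗ L))))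
pascal-product-step A₁ A₀ Pj Pl Pm U Y L Q h₁ h₀ = begin
  (A₁ ⊞ Y ⊗ (Q ⊗ L) ⊗ A₀) ⊗ (Pj ⊗ 1- (Q ⊗ Y)) ⊗ (Pl ⊗ 1- (Q ⊗ L))
    ≈⟨ solve 7 (λ A₁ A₀ Pj Pl Y L Q →
         (A₁ :+ Y :* (Q :* L) :* A₀) :* (Pj :* (con 1ℤ :- Q :* Y)) :* (Pl :* (con 1ℤ :- Q :* L))
         := A₁ :* (Pj :* (con 1ℤ :- Q :* Y)) :* Pl :* (con 1ℤ :- Q :* L)
            :+ Y :* (Q :* L) :* (con 1ℤ :- Q :* Y) :* (A₀ :* Pj :* (Pl :* (con 1ℤ :- Q :* L))))
         ≐-refl A₁ A₀ Pj Pl Y L Q ⟩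
  A₁ ⊗ (Pj ⊗ 1- (Q ⊗ Y)) ⊗ Pl ⊗ 1- (Q ⊗ L) ⊞ Y ⊗ (Q ⊗ L) ⊗ 1- (Q ⊗ Y) ⊗ (A₀ ⊗ Pj ⊗ (Pl ⊗ 1- (Q ⊗ L)))
    ≈⟨ ⊞-cong (⊗-congʳ h₁) (⊗-congˡ h₀) ⟩
  U ⊗ Y ⊗ Pm ⊗ 1- (Q ⊗ L) ⊞ Y ⊗ (Q ⊗ L) ⊗ 1- (Q ⊗ Y) ⊗ (U ⊗ Pm)
    ≈⟨ solve 5 (λ Pm U Y L Q →
         U :* Y :* Pm :* (con 1ℤ :- Q :* L) :+ Y :* (Q :* L) :* (con 1ℤ :- Q :* Y) :* (U :* Pm)
         := U :* Y :* (Pm :* (con 1ℤ :- Q :* (Y :* (Q :* L)))))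
         ≐-refl Pm U Y L Q ⟩
  U ⊗ Y ⊗ (Pm ⊗ 1- (Q ⊗ (Y ⊗ (Q ⊗ L)))) ∎
  where open ≐-Reasoning

esym-product : ∀ s j l → esym s 0 (j + l) j ⊗ poch s j ⊗ poch s l ≐ q^ (choose₂ j * s) ⊗ poch s (j + l)
esym-product s zero l = ⊗-congʳ (≐-trans (⊗-identityʳ _) (esym-zero s 0 l))
esym-product s (suc j) zero rewrite ℕₚ.+-identityʳ j =
  ≐-trans (⊗-identityʳ _) (⊗-congʳ (esym-diagonal s (suc j)))
esym-product s (suc j) (suc l) = begin
  (A₁ ⊞ q^ (m * s) ⊗ A₀) ⊗ (Pj ⊗ 1- q^ (suc j * s)) ⊗ (Pl ⊗ 1- q^ (suc l * s))
    ≈⟨ ⊗-cong (⊗-cong (⊞-congˡ (⊗-congʳ qm)) (⊗-congˡ (1-‿cong (q^-+ s (j * s)))))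
              (⊗-congˡ (1-‿cong (q^-+ s (l * s)))) ⟩
  (A₁ ⊞ Y ⊗ (Q ⊗ L) ⊗ A₀) ⊗ (Pj ⊗ 1- (Q ⊗ Y)) ⊗ (Pl ⊗ 1- (Q ⊗ L))
    ≈⟨ pascal-product-step A₁ A₀ Pj Pl Pm U Y L Q h₁ h₀ ⟩
  U ⊗ Y ⊗ (Pm ⊗ 1- (Q ⊗ (Y ⊗ (Q ⊗ L))))
    ≈⟨ ⊗-cong (≐-sym (q^-scaled-+ (choose₂ j) j s)) (⊗-congˡ (1-‿cong (≐-sym (≐-trans (q^-+ s (m * s)) (⊗-congˡ qm))))) ⟩
  q^ (choose₂ (suc j) * s) ⊗ poch s (suc m) ∎
  where
  open ≐-Reasoning
  m  = j + suc l
  A₁ = esym s 0 m (suc j)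
  A₀ = esym s 0 m j
  Pj = poch s j
  Pl = poch s l
  Pm = poch s m
  U  = q^ (choose₂ j * s)
  Y  = q^ (j * s)
  L  = q^ (l * s)
  Q  = q^ s
  qm : q^ (m * s) ≐ Y ⊗ (Q ⊗ L)
  qm = ≐-trans (q^-scaled-+ j (suc l) s) (⊗-congˡ (q^-+ s (l * s)))
  h₁ : A₁ ⊗ (Pj ⊗ 1- (Q ⊗ Y)) ⊗ Pl ≐ U ⊗ Y ⊗ Pm
  h₁ = begin
    A₁ ⊗ (Pj ⊗ 1- (Q ⊗ Y)) ⊗ Pl                         ≈⟨ ⊗-congʳ (⊗-congˡ (⊗-congˡ (1-‿cong (≐-sym (q^-+ s (j * s)))))) ⟩
    A₁ ⊗ poch s (suc j) ⊗ Pl                            ≈⟨ ≐-reflexive (cong (λ n → esym s 0 n (suc j) ⊗ poch s (suc j) ⊗ Pl) (ℕₚ.+-suc j l)) ⟩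
    esym s 0 (suc j + l) (suc j) ⊗ poch s (suc j) ⊗ Pl  ≈⟨ esym-product s (suc j) l ⟩
    q^ (choose₂ (suc j) * s) ⊗ poch s (suc j + l)       ≈⟨ ⊗-cong (q^-scaled-+ (choose₂ j) j s) (≐-reflexive (cong (poch s) (sym (ℕₚ.+-suc j l)))) ⟩
    U ⊗ Y ⊗ Pm                                          ∎
  h₀ : A₀ ⊗ Pj ⊗ (Pl ⊗ 1- (Q ⊗ L)) ≐ U ⊗ Pm
  h₀ = ≐-trans (⊗-congˡ (⊗-congˡ (1-‿cong (≐-sym (q^-+ s (l * s)))))) (esym-product s j (suc l))

prev : (ℕ → Series) → ℕ → Series
prev r zero    = 0ˢ
prev r (suc j) = r j

prev-cong : ∀ {r r′} → (∀ i → r i ≐ r′ i) → ∀ j → prev r j ≐ prev r′ j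
prev-cong eq zero    = ≐-refl
prev-cong eq (suc j) = eq j

prev-⊞ : ∀ r r′ j → prev (λ i → r i ⊞ r′ i) j ≐ prev r j ⊞ prev r′ j
prev-⊞ r r′ zero    = ≐-sym (⊞-identityˡ 0ˢ)
prev-⊞ r r′ (suc j) = ≐-refl

prev-⊗ : ∀ u r j → prev (λ i → u ⊗ r i) j ≐ u ⊗ prev r j
prev-⊗ u r zero    = ≐-sym (⊗-zeroʳ u)
prev-⊗ u r (suc j) = ≐-refl

weighted : ℕ → ℕ → ℕ → Series
weighted s n j = q^ (j * s) ⊗ esym s 0 n j

esym-pascal : ∀ s n j → esym s 0 (suc n) j ≐ esym s 0 n j ⊞ q^ (n * s) ⊗ prev (esym s 0 n) j
esym-pascal s n zero    = ≐-sym (≐-trans (⊞-cong (esym-zero s 0 n) (⊗-zeroʳ _)) (⊞-identityʳ one))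
esym-pascal s n (suc j) = ≐-refl

esym-dual-pascal : ∀ s n j → esym s 0 (suc n) j ≐ prev (weighted s n) j ⊞ weighted s n j
esym-dual-pascal s n zero    = ≐-sym (≐-trans (⊞-identityˡ _) (≐-trans (⊗-identityˡ _) (esym-zero s 0 n)))
esym-dual-pascal s n (suc j) = ≐-trans (esym-front s 0 n j)
  (⊞-cong (≐-trans (⊗-identityˡ _) (esym-homogeneous s 0 n j)) (esym-homogeneous s 0 n (suc j)))

esym-two-step : ∀ s n j →
  esym s 0 (suc (suc n)) j ≐
  weighted s n j ⊞ (one ⊞ q^ (suc n * s)) ⊗ prev (weighted s n) j ⊞ q^ (suc n * s) ⊗ prev (prev (weighted s n)) j
esym-two-step s n j = begin
  esym s 0 (suc (suc n)) j
    ≈⟨ esym-pascal s (suc n) j ⟩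
  esym s 0 (suc n) j ⊞ M ⊗ prev (esym s 0 (suc n)) j
    ≈⟨ ⊞-cong (esym-dual-pascal s n j) (⊗-congˡ (≐-trans (prev-cong (esym-dual-pascal s n) j) (prev-⊞ _ _ j))) ⟩
  (p₁ ⊞ w) ⊞ M ⊗ (p₂ ⊞ p₁)
    ≈⟨ solve 4 (λ w p₁ p₂ M → (p₁ :+ w) :+ M :* (p₂ :+ p₁) := w :+ (con 1ℤ :+ M) :* p₁ :+ M :* p₂) ≐-refl w p₁ p₂ M ⟩
  w ⊞ (one ⊞ M) ⊗ p₁ ⊞ M ⊗ p₂ ∎
  where
  open ≐-Reasoning
  M  = q^ (suc n * s)
  w  = weighted s n j
  p₁ = prev (weighted s n) j
  p₂ = prev (prev (weighted s n)) j

-- Laurent series in z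

infix 4 _≐ᶻ_
_≐ᶻ_ : ZSeries → ZSeries → Set
F ≐ᶻ G = ∀ k → F k ≐ G k

≤ᵇ-below : ∀ {b n} → n < b → (b ℕ.≤ᵇ n) ≡ false
≤ᵇ-below {b} {n} n<b with b ℕ.≤ᵇ n | ℕₚ.≤ᵇ⇒≤ b n
... | false | _   = refl
... | true  | b≤n = ⊥-elim (ℕₚ.<⇒≱ n<b (b≤n _))

≤ᵇ-above : ∀ b m → (b ℕ.≤ᵇ (b + m)) ≡ true
≤ᵇ-above b m with b ℕ.≤ᵇ (b + m) | ℕₚ.≤⇒≤ᵇ {b} {b + m} (ℕₚ.m≤m+n b m)
... | true | _ = refl

timesBin-as-⊞ : ∀ a b F → timesBin a b F ≐ᶻ λ k → F k ⊞ q^ b ⊗ F (k ℤ.- a)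
timesBin-as-⊞ a b F k = coeffwise coeffAt
  where
  coeffAt : ∀ n → timesBin a b F k n ≡ (F k ⊞ q^ b ⊗ F (k ℤ.- a)) n
  coeffAt n with offset b n
  ... | below n<b rewrite ≤ᵇ-below n<b =
    sym (trans (⊞-coeff (F k) _ n) (cong (ℤ._+_ (F k n)) (q^-⊗-below b (F (k ℤ.- a)) n n<b)))
  ... | above m rewrite ≤ᵇ-above b m =
    sym (trans (⊞-coeff (F k) _ (b + m)) (cong (ℤ._+_ (F k (b + m)))
      (trans (q^-⊗-above b (F (k ℤ.- a)) m) (cong (F (k ℤ.- a)) (sym (ℕₚ.m+n∸m≡n b m))))))

timesBin-cong : ∀ a b {F G} → F ≐ᶻ G → timesBin a b F ≐ᶻ timesBin a b G
timesBin-cong a b {F} {G} F≐G k = ≐-trans (timesBin-as-⊞ a b F k)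
  (≐-trans (⊞-cong (F≐G k) (⊗-congˡ (F≐G (k ℤ.- a)))) (≐-sym (timesBin-as-⊞ a b G k)))

timesBin-comm : ∀ a b a′ b′ F → timesBin a b (timesBin a′ b′ F) ≐ᶻ timesBin a′ b′ (timesBin a b F)
timesBin-comm a b a′ b′ F k = begin
  timesBin a b (timesBin a′ b′ F) k
    ≈⟨ ≐-trans (timesBin-as-⊞ a b (timesBin a′ b′ F) k) (⊞-cong (timesBin-as-⊞ a′ b′ F k) (⊗-congˡ (timesBin-as-⊞ a′ b′ F (k ℤ.- a)))) ⟩
  (F k ⊞ q^ b′ ⊗ F (k ℤ.- a′)) ⊞ q^ b ⊗ (F (k ℤ.- a) ⊞ q^ b′ ⊗ F (k ℤ.- a ℤ.- a′))
    ≈⟨ ⊞-congˡ (⊗-congˡ (⊞-congˡ (⊗-congˡ (≐-reflexive (cong F reorder))))) ⟩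
  (F k ⊞ q^ b′ ⊗ F (k ℤ.- a′)) ⊞ q^ b ⊗ (F (k ℤ.- a) ⊞ q^ b′ ⊗ F (k ℤ.- a′ ℤ.- a))
    ≈⟨ solve 6 (λ x y z w u v → (x :+ v :* y) :+ u :* (z :+ v :* w) := (x :+ u :* z) :+ v :* (y :+ u :* w))
               ≐-refl (F k) (F (k ℤ.- a′)) (F (k ℤ.- a)) (F (k ℤ.- a′ ℤ.- a)) (q^ b) (q^ b′) ⟩
  (F k ⊞ q^ b ⊗ F (k ℤ.- a)) ⊞ q^ b′ ⊗ (F (k ℤ.- a′) ⊞ q^ b ⊗ F (k ℤ.- a′ ℤ.- a))
    ≈⟨ ≐-sym (≐-trans (timesBin-as-⊞ a′ b′ (timesBin a b F) k) (⊞-cong (timesBin-as-⊞ a b F k) (⊗-congˡ (timesBin-as-⊞ a b F (k ℤ.- a′))))) ⟩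
  timesBin a′ b′ (timesBin a b F) k ∎
  where
  open ≐-Reasoning
  reorder : k ℤ.- a ℤ.- a′ ≡ k ℤ.- a′ ℤ.- a
  reorder = ℤ-Ring.solve (k ∷ a ∷ a′ ∷ [])

timesFactors : ℕ → ℕ → ZSeries → ZSeries
timesFactors s zero    F = F
timesFactors s (suc N) F = timesBin 1ℤ (suc N * s) (timesBin -1ℤ (N * s) (timesFactors s N F))

timesFactors-cong : ∀ s N {F G} → F ≐ᶻ G → timesFactors s N F ≐ᶻ timesFactors s N G
timesFactors-cong s zero    F≐G = F≐G
timesFactors-cong s (suc N) F≐G = timesBin-cong 1ℤ (suc N * s) (timesBin-cong -1ℤ (N * s) (timesFactors-cong s N F≐G))

timesFactors-timesBin : ∀ s N a b F → timesFactors s N (timesBin a b F) ≐ᶻ timesBin a b (timesFactors s N F)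
timesFactors-timesBin s zero    a b F k = ≐-refl
timesFactors-timesBin s (suc N) a b F k = begin
  T₁ (T₋ (timesFactors s N (timesBin a b F))) k  ≈⟨ timesBin-cong 1ℤ (suc N * s) (timesBin-cong -1ℤ (N * s) (timesFactors-timesBin s N a b F)) k ⟩
  T₁ (T₋ (timesBin a b (timesFactors s N F))) k  ≈⟨ timesBin-cong 1ℤ (suc N * s) (timesBin-comm -1ℤ (N * s) a b (timesFactors s N F)) k ⟩
  T₁ (timesBin a b (T₋ (timesFactors s N F))) k  ≈⟨ timesBin-comm 1ℤ (suc N * s) a b (T₋ (timesFactors s N F)) k ⟩
  timesBin a b (T₁ (T₋ (timesFactors s N F))) k  ∎
  where
  open ≐-Reasoning
  T₁ T₋ : ZSeries → ZSeries
  T₁ = timesBin 1ℤ (suc N * s)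
  T₋ = timesBin -1ℤ (N * s)

prodL-as-square : ∀ N → prodL N ≐ᶻ timesFactors 1 N (timesFactors 1 N oneZ)
prodL-as-square zero    k = ≐-refl
prodL-as-square (suc N) k = begin
  T₁ (T₁ (T₋ (T₋ (prodL N)))) k
    ≈⟨ timesBin-cong 1ℤ (suc N) (timesBin-cong 1ℤ (suc N) (timesBin-cong -1ℤ N (timesBin-cong -1ℤ N (prodL-as-square N)))) k ⟩
  T₁ (T₁ (T₋ (T₋ (X (X oneZ))))) k
    ≈⟨ timesBin-cong 1ℤ (suc N) (timesBin-comm 1ℤ (suc N) -1ℤ N (T₋ (X (X oneZ)))) k ⟩
  T₁ (T₋ (T₁ (T₋ (X (X oneZ))))) k
    ≈⟨ timesBin-cong 1ℤ (suc N) (timesBin-cong -1ℤ N inner) k ⟩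
  T₁ (T₋ (X (T₁ (T₋ (X oneZ))))) k
    ≡⟨ cong (λ F → F k) unitExponents ⟩
  timesFactors 1 (suc N) (timesFactors 1 (suc N) oneZ) k ∎
  where
  open ≐-Reasoning
  T₁ T₋ X : ZSeries → ZSeries
  T₁ = timesBin 1ℤ (suc N)
  T₋ = timesBin -1ℤ N
  X  = timesFactors 1 N
  inner : T₁ (T₋ (X (X oneZ))) ≐ᶻ X (T₁ (T₋ (X oneZ)))
  inner k = ≐-sym (≐-trans (timesFactors-timesBin 1 N 1ℤ (suc N) (T₋ (X oneZ)) k)
                           (timesBin-cong 1ℤ (suc N) (timesFactors-timesBin 1 N -1ℤ N (X oneZ)) k))
  unitExponents : T₁ (T₋ (X (T₁ (T₋ (X oneZ))))) ≡ timesFactors 1 (suc N) (timesFactors 1 (suc N) oneZ)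
  unitExponents = cong₂ (λ b₁ b₀ → timesBin 1ℤ b₁ (timesBin -1ℤ b₀ (X (timesBin 1ℤ b₁ (timesBin -1ℤ b₀ (X oneZ))))))
                        (sym (ℕₚ.*-identityʳ (suc N))) (sym (ℕₚ.*-identityʳ N))

-- The coefficient of z^(j − N) in ∏_{λ<N} (1 + z q^((λ+1)s)) (1 + z⁻¹ q^(λs)).
zCoefficient : ℕ → ℕ → ℕ → Series
zCoefficient s zero    zero    = one
zCoefficient s zero    (suc j) = 0ˢ
zCoefficient s (suc N) j =
  q^ (N * s) ⊗ zCoefficient s N j ⊞ (one ⊞ q^ (suc (N + N) * s)) ⊗ prev (zCoefficient s N) j
  ⊞ q^ (suc N * s) ⊗ prev (prev (zCoefficient s N)) j

zCoefficient-vanishes : ∀ s N {i} → N + N < i → zCoefficient s N i ≐ 0ˢ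
zCoefficient-vanishes s zero    {suc i} _      = ≐-refl
zCoefficient-vanishes s (suc N) {i}     2N+2<i = begin
  q^ (N * s) ⊗ c i ⊞ V ⊗ prev c i ⊞ q^ (suc N * s) ⊗ prev (prev c) i
    ≈⟨ ⊞-cong (⊞-cong (⊗-congˡ (zCoefficient-vanishes s N (ℕₚ.<-trans (ℕₚ.+-mono-< (ℕₚ.n<1+n N) (ℕₚ.n<1+n N)) 2N+2<i)))
                      (⊗-congˡ (prev-vanishes i 2N+2<i)))
              (⊗-congˡ (prev²-vanishes i 2N+2<i)) ⟩
  q^ (N * s) ⊗ 0ˢ ⊞ V ⊗ 0ˢ ⊞ q^ (suc N * s) ⊗ 0ˢ
    ≈⟨ ≐-trans (⊞-cong (⊞-cong (⊗-zeroʳ _) (⊗-zeroʳ _)) (⊗-zeroʳ _)) (≐-trans (⊞-identityʳ _) (⊞-identityʳ 0ˢ)) ⟩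
  0ˢ ∎
  where
  open ≐-Reasoning
  c = zCoefficient s N
  V = one ⊞ q^ (suc (N + N) * s)
  2N<2N+1 : N + N < N + suc N
  2N<2N+1 = ℕₚ.+-monoʳ-< N (ℕₚ.n<1+n N)
  prev-vanishes : ∀ i → suc N + suc N < i → prev c i ≐ 0ˢ
  prev-vanishes (suc i) (s≤s 2N+1<i) = zCoefficient-vanishes s N (ℕₚ.<-trans 2N<2N+1 2N+1<i)
  prev²-vanishes : ∀ i → suc N + suc N < i → prev (prev c) i ≐ 0ˢ
  prev²-vanishes (suc (suc i)) (s≤s (s≤s 2N+1≤i)) = zCoefficient-vanishes s N (ℕₚ.<-≤-trans 2N<2N+1 2N+1≤i)

timesFactors-step : ∀ s N F k → timesFactors s (suc N) F k ≐
  q^ (N * s) ⊗ timesFactors s N F (k ℤ.+ 1ℤ) ⊞ (one ⊞ q^ (suc (N + N) * s)) ⊗ timesFactors s N F k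
  ⊞ q^ (suc N * s) ⊗ timesFactors s N F (k ℤ.- 1ℤ)
timesFactors-step s N F k = begin
  timesBin 1ℤ (suc N * s) (timesBin -1ℤ (N * s) H) k
    ≈⟨ timesBin-as-⊞ 1ℤ (suc N * s) (timesBin -1ℤ (N * s) H) k ⟩
  timesBin -1ℤ (N * s) H k ⊞ b ⊗ timesBin -1ℤ (N * s) H (k ℤ.- 1ℤ)
    ≈⟨ ⊞-cong (timesBin-as-⊞ -1ℤ (N * s) H k) (⊗-congˡ (timesBin-as-⊞ -1ℤ (N * s) H (k ℤ.- 1ℤ))) ⟩
  (H k ⊞ a ⊗ H (k ℤ.- -1ℤ)) ⊞ b ⊗ (H (k ℤ.- 1ℤ) ⊞ a ⊗ H (k ℤ.- 1ℤ ℤ.- -1ℤ))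
    ≈⟨ ⊞-cong (⊞-congˡ (⊗-congˡ (≐-reflexive (cong H up)))) (⊗-congˡ (⊞-congˡ (⊗-congˡ (≐-reflexive (cong H back))))) ⟩
  (H k ⊞ a ⊗ H (k ℤ.+ 1ℤ)) ⊞ b ⊗ (H (k ℤ.- 1ℤ) ⊞ a ⊗ H k)
    ≈⟨ solve 5 (λ h₀ h₊ h₋ a b → (h₀ :+ a :* h₊) :+ b :* (h₋ :+ a :* h₀) := a :* h₊ :+ (con 1ℤ :+ b :* a) :* h₀ :+ b :* h₋)
               ≐-refl (H k) (H (k ℤ.+ 1ℤ)) (H (k ℤ.- 1ℤ)) a b ⟩
  a ⊗ H (k ℤ.+ 1ℤ) ⊞ (one ⊞ b ⊗ a) ⊗ H k ⊞ b ⊗ H (k ℤ.- 1ℤ)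
    ≈⟨ ⊞-congʳ (⊞-congˡ (⊗-congʳ (⊞-congˡ (≐-sym (≐-trans (q^-exponent exponents) (q^-+ (suc N * s) (N * s))))))) ⟩
  a ⊗ H (k ℤ.+ 1ℤ) ⊞ (one ⊞ q^ (suc (N + N) * s)) ⊗ H k ⊞ b ⊗ H (k ℤ.- 1ℤ) ∎
  where
  open ≐-Reasoning
  H = timesFactors s N F
  a = q^ (N * s)
  b = q^ (suc N * s)
  up : k ℤ.- -1ℤ ≡ k ℤ.+ 1ℤ
  up = ℤ-Ring.solve (k ∷ [])
  back : k ℤ.- 1ℤ ℤ.- -1ℤ ≡ k
  back = ℤ-Ring.solve (k ∷ [])
  exponents : suc (N + N) * s ≡ suc N * s + N * s
  exponents = ℕ-Ring.solve (N ∷ s ∷ [])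

zIndex : ℤ → ℕ → ℕ → ℤ
zIndex k N i = k ℤ.+ ℤ.+ N ℤ.- ℤ.+ i

zTerm : ℕ → ℕ → ZSeries → ℤ → ℕ → Series
zTerm s N F k i = zCoefficient s N i ⊗ F (zIndex k N i)

rowSum : ℕ → ℕ → ZSeries → ℤ → Series
rowSum s N F k = ∑ˢ (suc (N + N)) (zTerm s N F k)

zCoefficient-⊗-vanishes : ∀ s N x {i} → suc (N + N) ≤ i → zCoefficient s N i ⊗ x ≐ 0ˢ
zCoefficient-⊗-vanishes s N x 2N<i = ≐-trans (⊗-congʳ (zCoefficient-vanishes s N 2N<i)) (⊗-zeroˡ x)

module _ (s N : ℕ) (F : ZSeries) (k : ℤ) where

  private
    c G : ℕ → Series
    c = zCoefficient s N
    G i = F (zIndex k (suc N) i)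
    2N+1≤2N+2 : suc (N + N) ≤ suc (N + suc N)
    2N+1≤2N+2 = s≤s (ℕₚ.+-monoʳ-≤ N (ℕₚ.n≤1+n N))

  rowSum-raised : rowSum s N F (k ℤ.+ 1ℤ) ≐ ∑ˢ (suc (suc N + suc N)) (λ i → c i ⊗ G i)
  rowSum-raised = begin
    rowSum s N F (k ℤ.+ 1ℤ)
      ≈⟨ ∑ˢ-cong (suc (N + N)) {zTerm s N F (k ℤ.+ 1ℤ)} (λ i _ → ⊗-congˡ (≐-reflexive (cong F (index i)))) ⟩
    ∑ˢ (suc (N + N)) (λ i → c i ⊗ G i)
      ≈⟨ ≐-sym (∑ˢ-pad _ (suc (N + N)) (λ i → c i ⊗ G i) (ℕₚ.m≤n⇒m≤1+n 2N+1≤2N+2) (λ i → zCoefficient-⊗-vanishes s N (G i))) ⟩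
    ∑ˢ (suc (suc N + suc N)) (λ i → c i ⊗ G i) ∎
    where
    open ≐-Reasoning
    reassociate : ∀ k n i → k ℤ.+ 1ℤ ℤ.+ n ℤ.- i ≡ k ℤ.+ (1ℤ ℤ.+ n) ℤ.- i
    reassociate = ℤ-Ring.solve-∀
    index : ∀ i → zIndex (k ℤ.+ 1ℤ) N i ≡ zIndex k (suc N) i
    index i = reassociate k (ℤ.+ N) (ℤ.+ i)

  rowSum-shifted : rowSum s N F k ≐ ∑ˢ (suc (suc N + suc N)) (λ i → prev c i ⊗ G i)
  rowSum-shifted = begin
    rowSum s N F k
      ≈⟨ ∑ˢ-cong (suc (N + N)) {zTerm s N F k} (λ i _ → ⊗-congˡ (≐-reflexive (cong F (index i)))) ⟩
    ∑ˢ (suc (N + N)) (λ i → c i ⊗ G (suc i))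
      ≈⟨ ≐-sym (∑ˢ-pad _ (suc (N + N)) (λ i → c i ⊗ G (suc i)) 2N+1≤2N+2 (λ i → zCoefficient-⊗-vanishes s N (G (suc i)))) ⟩
    ∑ˢ (suc (N + suc N)) (λ i → c i ⊗ G (suc i))
      ≈⟨ ≐-sym (≐-trans (⊞-congʳ (⊗-zeroˡ (G 0))) (⊞-identityˡ _)) ⟩
    ∑ˢ (suc (suc N + suc N)) (λ i → prev c i ⊗ G i) ∎
    where
    open ≐-Reasoning
    cancel : ∀ k n i → k ℤ.+ n ℤ.- i ≡ k ℤ.+ (1ℤ ℤ.+ n) ℤ.- (1ℤ ℤ.+ i)
    cancel = ℤ-Ring.solve-∀
    index : ∀ i → zIndex k N i ≡ zIndex k (suc N) (suc i)
    index i = cancel k (ℤ.+ N) (ℤ.+ i)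

  rowSum-lowered : rowSum s N F (k ℤ.- 1ℤ) ≐ ∑ˢ (suc (suc N + suc N)) (λ i → prev (prev c) i ⊗ G i)
  rowSum-lowered = begin
    rowSum s N F (k ℤ.- 1ℤ)
      ≈⟨ ∑ˢ-cong (suc (N + N)) {zTerm s N F (k ℤ.- 1ℤ)} (λ i _ → ⊗-congˡ (≐-reflexive (cong F (index i)))) ⟩
    ∑ˢ (suc (N + N)) (λ i → c i ⊗ G (suc (suc i)))
      ≡⟨ cong (λ n → ∑ˢ n (λ i → c i ⊗ G (suc (suc i)))) (sym (ℕₚ.+-suc N N)) ⟩
    ∑ˢ (N + suc N) (λ i → c i ⊗ G (suc (suc i)))
      ≈⟨ ≐-sym (≐-trans (⊞-congʳ (⊗-zeroˡ (G 0)))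
                (≐-trans (⊞-identityˡ _) (≐-trans (⊞-congʳ (⊗-zeroˡ (G 1))) (⊞-identityˡ _)))) ⟩
    ∑ˢ (suc (suc N + suc N)) (λ i → prev (prev c) i ⊗ G i) ∎
    where
    open ≐-Reasoning
    reassociate : ∀ k n i → k ℤ.- 1ℤ ℤ.+ n ℤ.- i ≡ k ℤ.+ (1ℤ ℤ.+ n) ℤ.- (1ℤ ℤ.+ (1ℤ ℤ.+ i))
    reassociate = ℤ-Ring.solve-∀
    index : ∀ i → zIndex (k ℤ.- 1ℤ) N i ≡ zIndex k (suc N) (suc (suc i))
    index i = reassociate k (ℤ.+ N) (ℤ.+ i)

timesFactors-expansion : ∀ s N F k → timesFactors s N F k ≐ rowSum s N F k
timesFactors-expansion s zero    F k = begin
  F k                     ≡⟨ cong F (neutral k) ⟩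
  F (zIndex k 0 0)        ≈⟨ ≐-sym (⊗-identityˡ _) ⟩
  one ⊗ F (zIndex k 0 0)  ≈⟨ ≐-sym (⊞-identityʳ _) ⟩
  rowSum s 0 F k          ∎
  where
  open ≐-Reasoning
  neutral : ∀ k → k ≡ k ℤ.+ 0ℤ ℤ.- 0ℤ
  neutral = ℤ-Ring.solve-∀
timesFactors-expansion s (suc N) F k = begin
  timesFactors s (suc N) F k
    ≈⟨ timesFactors-step s N F k ⟩
  a ⊗ timesFactors s N F (k ℤ.+ 1ℤ) ⊞ V ⊗ timesFactors s N F k ⊞ b ⊗ timesFactors s N F (k ℤ.- 1ℤ)
    ≈⟨ ⊞-cong (⊞-cong (⊗-congˡ (timesFactors-expansion s N F (k ℤ.+ 1ℤ))) (⊗-congˡ (timesFactors-expansion s N F k)))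
              (⊗-congˡ (timesFactors-expansion s N F (k ℤ.- 1ℤ))) ⟩
  a ⊗ rowSum s N F (k ℤ.+ 1ℤ) ⊞ V ⊗ rowSum s N F k ⊞ b ⊗ rowSum s N F (k ℤ.- 1ℤ)
    ≈⟨ ⊞-cong (⊞-cong (⊗-congˡ (rowSum-raised s N F k)) (⊗-congˡ (rowSum-shifted s N F k))) (⊗-congˡ (rowSum-lowered s N F k)) ⟩
  a ⊗ ∑ˢ L u₀ ⊞ V ⊗ ∑ˢ L u₁ ⊞ b ⊗ ∑ˢ L u₂
    ≈⟨ ⊞-cong (⊞-cong (⊗-∑ˢ L a u₀) (⊗-∑ˢ L V u₁)) (⊗-∑ˢ L b u₂) ⟩
  ∑ˢ L (λ i → a ⊗ u₀ i) ⊞ ∑ˢ L (λ i → V ⊗ u₁ i) ⊞ ∑ˢ L (λ i → b ⊗ u₂ i)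
    ≈⟨ ≐-sym (≐-trans (∑ˢ-+ L (λ i → a ⊗ u₀ i ⊞ V ⊗ u₁ i) (λ i → b ⊗ u₂ i))
                      (⊞-congʳ (∑ˢ-+ L (λ i → a ⊗ u₀ i) (λ i → V ⊗ u₁ i)))) ⟩
  ∑ˢ L (λ i → a ⊗ u₀ i ⊞ V ⊗ u₁ i ⊞ b ⊗ u₂ i)
    ≈⟨ ∑ˢ-cong L {λ i → a ⊗ u₀ i ⊞ V ⊗ u₁ i ⊞ b ⊗ u₂ i} {zTerm s (suc N) F k}
         (λ i _ → solve 7 (λ a V b x y z g → a :* (x :* g) :+ V :* (y :* g) :+ b :* (z :* g)
                                           := (a :* x :+ V :* y :+ b :* z) :* g)
                          ≐-refl a V b (c i) (prev c i) (prev (prev c) i) (G i)) ⟩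
  rowSum s (suc N) F k ∎
  where
  open ≐-Reasoning
  c = zCoefficient s N
  a = q^ (N * s)
  b = q^ (suc N * s)
  V = one ⊞ q^ (suc (N + N) * s)
  L = suc (suc N + suc N)
  G u₀ u₁ u₂ : ℕ → Series
  G i  = F (zIndex k (suc N) i)
  u₀ i = c i ⊗ G i
  u₁ i = prev c i ⊗ G i
  u₂ i = prev (prev c) i ⊗ G i

oneZ-nonzero : ∀ k → k ≢ 0ℤ → oneZ k ≐ 0ˢ
oneZ-nonzero k k≢0 = coeffwise coeffAt
  where
  coeffAt : ∀ n → oneZ k n ≡ 0ℤ
  coeffAt n with k ℤ.≟ 0ℤ
  ... | yes k≡0 = ⊥-elim (k≢0 k≡0)
  ... | no _    = refl

pairIndex : ∀ N i j → zIndex (zIndex -1ℤ N i) N j ≡ ℤ.+ (N + N) ℤ.- ℤ.+ suc (i + j)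
pairIndex N i j = regroup (ℤ.+ N) (ℤ.+ i) (ℤ.+ j)
  where
  regroup : ∀ n i j → -1ℤ ℤ.+ n ℤ.- i ℤ.+ n ℤ.- j ≡ n ℤ.+ n ℤ.- (1ℤ ℤ.+ (i ℤ.+ j))
  regroup = ℤ-Ring.solve-∀

pairIndex≡0 : ∀ N i j → zIndex (zIndex -1ℤ N i) N j ≡ 0ℤ → suc (i + j) ≡ N + N
pairIndex≡0 N i j eq = sym (ℤₚ.+-injective (ℤₚ.i-j≡0⇒i≡j _ _ (trans (sym (pairIndex N i j)) eq)))

partner-coefficient : ∀ s N i → i < N + N →
  timesFactors s N oneZ (zIndex -1ℤ N i) ≐ zCoefficient s N (N + N ∸ suc i)
partner-coefficient s N i i<2N = begin
  timesFactors s N oneZ (zIndex -1ℤ N i)                     ≈⟨ timesFactors-expansion s N oneZ (zIndex -1ℤ N i) ⟩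
  ∑ˢ (suc (N + N)) (zTerm s N oneZ (zIndex -1ℤ N i))         ≈⟨ ∑ˢ-single (suc (N + N)) j₀ _ (s≤s (ℕₚ.m∸n≤m (N + N) (suc i))) others ⟩
  zCoefficient s N j₀ ⊗ oneZ (zIndex (zIndex -1ℤ N i) N j₀)  ≈⟨ ⊗-congˡ (≐-reflexive (cong oneZ atPartner)) ⟩
  zCoefficient s N j₀ ⊗ one                                  ≈⟨ ⊗-identityʳ _ ⟩
  zCoefficient s N j₀                                        ∎
  where
  open ≐-Reasoning
  j₀ = N + N ∸ suc i
  atPartner : zIndex (zIndex -1ℤ N i) N j₀ ≡ 0ℤ
  atPartner = trans (pairIndex N i j₀) (trans (cong (λ m → ℤ.+ (N + N) ℤ.- ℤ.+ m) (ℕₚ.m+[n∸m]≡n {suc i} i<2N))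
                                             (ℤₚ.+-inverseʳ (ℤ.+ (N + N))))
  others : ∀ j → j < suc (N + N) → j ≢ j₀ → zTerm s N oneZ (zIndex -1ℤ N i) j ≐ 0ˢ
  others j _ j≢j₀ = ≐-trans (⊗-congˡ (oneZ-nonzero _ λ eq → j≢j₀ (sym (partner eq)))) (⊗-zeroʳ _)
    where
    partner : zIndex (zIndex -1ℤ N i) N j ≡ 0ℤ → j₀ ≡ j
    partner eq = trans (cong (_∸ suc i) (sym (pairIndex≡0 N i j eq))) (ℕₚ.m+n∸m≡n (suc i) j)

partner-vanishes : ∀ s N → timesFactors s N oneZ (zIndex -1ℤ N (N + N)) ≐ 0ˢ
partner-vanishes s N = ≐-trans (timesFactors-expansion s N oneZ (zIndex -1ℤ N (N + N)))
  (∑ˢ-zero (suc (N + N)) {zTerm s N oneZ (zIndex -1ℤ N (N + N))} λ j _ →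
    ≐-trans (⊗-congˡ (oneZ-nonzero _ (λ eq → ℕₚ.m≢1+m+n (N + N) (sym (pairIndex≡0 N (N + N) j eq))))) (⊗-zeroʳ _))

square-coefficient : ∀ s N →
  timesFactors s N (timesFactors s N oneZ) -1ℤ ≐ ∑ˢ (N + N) (λ i → zCoefficient s N i ⊗ zCoefficient s N (N + N ∸ suc i))
square-coefficient s N = begin
  timesFactors s N X -1ℤ              ≈⟨ timesFactors-expansion s N X -1ℤ ⟩
  ∑ˢ (suc (N + N)) (zTerm s N X -1ℤ)  ≈⟨ ∑ˢ-last (N + N) (zTerm s N X -1ℤ) ⟩
  ∑ˢ (N + N) (zTerm s N X -1ℤ) ⊞ zTerm s N X -1ℤ (N + N)
    ≈⟨ ⊞-cong (∑ˢ-cong (N + N) {zTerm s N X -1ℤ} (λ i i<2N → ⊗-congˡ (partner-coefficient s N i i<2N)))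
              (≐-trans (⊗-congˡ (partner-vanishes s N)) (⊗-zeroʳ _)) ⟩
  ∑ˢ (N + N) (λ i → zCoefficient s N i ⊗ zCoefficient s N (N + N ∸ suc i)) ⊞ 0ˢ
    ≈⟨ ⊞-identityʳ _ ⟩
  ∑ˢ (N + N) (λ i → zCoefficient s N i ⊗ zCoefficient s N (N + N ∸ suc i)) ∎
  where
  open ≐-Reasoning
  X = timesFactors s N oneZ

factorsAtOne : ℕ → ℕ → Series
factorsAtOne s zero    = one
factorsAtOne s (suc N) = (one ⊞ q^ (suc N * s)) ⊗ ((one ⊞ q^ (N * s)) ⊗ factorsAtOne s N)

timesFactors-one : ∀ s N k → timesFactors s N (λ _ → one) k ≐ factorsAtOne s N
timesFactors-one s zero    k = ≐-refl
timesFactors-one s (suc N) k = ≐-trans (timesBin-as-⊞ 1ℤ (suc N * s) (timesBin -1ℤ (N * s) X) k)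
  (≐-trans (⊞-cong (inner k) (⊗-congˡ (inner (k ℤ.- 1ℤ)))) (factorOut (q^ (suc N * s)) _))
  where
  X = timesFactors s N (λ _ → one)
  factorOut : ∀ a x → x ⊞ a ⊗ x ≐ (one ⊞ a) ⊗ x
  factorOut = solve 2 (λ a x → x :+ a :* x := (con 1ℤ :+ a) :* x) ≐-refl
  inner : ∀ k → timesBin -1ℤ (N * s) X k ≐ (one ⊞ q^ (N * s)) ⊗ factorsAtOne s N
  inner k = ≐-trans (timesBin-as-⊞ -1ℤ (N * s) X k)
    (≐-trans (⊞-cong (timesFactors-one s N k) (⊗-congˡ (timesFactors-one s N (k ℤ.- -1ℤ)))) (factorOut (q^ (N * s)) _))

factorsAtOne-truncation : ∀ s {k K} → k ≤ K → factorsAtOne s K ≈[ k * s ] factorsAtOne s k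
factorsAtOne-truncation s {k} k≤K =
  subst (λ K → factorsAtOne s K ≈[ k * s ] factorsAtOne s k) (ℕₚ.m∸n+n≡m k≤K) (extend (_ ∸ k))
  where
  extend : ∀ d → factorsAtOne s (d + k) ≈[ k * s ] factorsAtOne s k
  extend zero    = ≈-refl
  extend (suc d) = ≈-trans (⊗-cong≈ (1+q^-≈one _ (ℕₚ.*-monoˡ-≤ s (ℕₚ.≤-trans (ℕₚ.m≤n+m k d) (ℕₚ.n≤1+n _))))
                                    (⊗-cong≈ (1+q^-≈one _ (ℕₚ.*-monoˡ-≤ s (ℕₚ.m≤n+m k d))) (extend d)))
                           (≐⇒≈ (≐-trans (⊗-identityˡ _) (⊗-identityˡ _)))

-- The z-coefficients are Gaussian binomials

twoStep : ℕ → ℕ → (ℕ → Series) → ℕ → Series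
twoStep s N r j =
  q^ ((j + suc N) * s) ⊗ (r j ⊞ (one ⊞ q^ (suc (N + N) * s)) ⊗ prev r j ⊞ q^ (suc (N + N) * s) ⊗ prev (prev r) j)

twoStep-cong : ∀ s N {r r′} → (∀ i → r i ≐ r′ i) → ∀ j → twoStep s N r j ≐ twoStep s N r′ j
twoStep-cong s N eq j =
  ⊗-congˡ (⊞-cong (⊞-cong (eq j) (⊗-congˡ (prev-cong eq j))) (⊗-congˡ (prev-cong (prev-cong eq) j)))

normalisedCoefficient : ℕ → ℕ → ℕ → Series
normalisedCoefficient s N j = q^ ((suc j * N) * s) ⊗ zCoefficient s N j

normalisedBinomial : ℕ → ℕ → ℕ → Series
normalisedBinomial s N j = q^ (choose₂ (suc N) * s) ⊗ weighted s (N + N) j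

normalisedCoefficient-step : ∀ s N j → normalisedCoefficient s (suc N) j ≐ twoStep s N (normalisedCoefficient s N) j
normalisedCoefficient-step s N j = ⊗-distrib₃-cong (q^-rebalance c₀ balance₀) (middle j) (last j)
  where
  c  = zCoefficient s N
  c₀ = c j
  V  = one ⊞ q^ (suc (N + N) * s)
  balance₀ : (suc j * suc N) * s + N * s ≡ (j + suc N) * s + (suc j * N) * s
  balance₀ = ℕ-Ring.solve (s ∷ N ∷ j ∷ [])
  middle : ∀ j → q^ ((suc j * suc N) * s) ⊗ (V ⊗ prev c j)
                 ≐ q^ ((j + suc N) * s) ⊗ (V ⊗ prev (normalisedCoefficient s N) j)
  middle zero    = ⊗-zero-both _ _ V V
  middle (suc i) = begin
    q^ ((suc (suc i) * suc N) * s) ⊗ (V ⊗ c i)                     ≈⟨ x∙yz≈y∙xz _ V (c i) ⟩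
    V ⊗ (q^ ((suc (suc i) * suc N) * s) ⊗ c i)                     ≈⟨ ⊗-congˡ (q^-split (c i) balance₁) ⟩
    V ⊗ (q^ ((suc i + suc N) * s) ⊗ (q^ ((suc i * N) * s) ⊗ c i))  ≈⟨ x∙yz≈y∙xz V _ _ ⟩
    q^ ((suc i + suc N) * s) ⊗ (V ⊗ (q^ ((suc i * N) * s) ⊗ c i))  ∎
    where
    open ≐-Reasoning
    balance₁ : (suc (suc i) * suc N) * s ≡ (suc i + suc N) * s + (suc i * N) * s
    balance₁ = ℕ-Ring.solve (s ∷ N ∷ i ∷ [])
  last : ∀ j → q^ ((suc j * suc N) * s) ⊗ (q^ (suc N * s) ⊗ prev (prev c) j)
               ≐ q^ ((j + suc N) * s) ⊗ (q^ (suc (N + N) * s) ⊗ prev (prev (normalisedCoefficient s N)) j)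
  last zero          = ⊗-zero-both _ _ _ _
  last (suc zero)    = ⊗-zero-both _ _ _ _
  last (suc (suc i)) = ≐-trans (q^-rebalance (c i) balance₂) (⊗-congˡ (≐-sym (q^-⊗-q^ _ _ (c i))))
    where
    balance₂ : (suc (suc (suc i)) * suc N) * s + suc N * s ≡ (suc (suc i) + suc N) * s + (suc (N + N) * s + (suc i * N) * s)
    balance₂ = ℕ-Ring.solve (s ∷ N ∷ i ∷ [])

normalisedBinomial-step : ∀ s N j → normalisedBinomial s (suc N) j ≐ twoStep s N (normalisedBinomial s N) j
normalisedBinomial-step s N j = begin
  q^ (choose₂ (suc (suc N)) * s) ⊗ (q^ (j * s) ⊗ esym s 0 (suc N + suc N) j)
    ≈⟨ ⊗-congˡ (⊗-congˡ (≐-trans (≐-reflexive (cong (λ n → esym s 0 n j) (ℕₚ.+-suc (suc N) N))) (esym-two-step s (N + N) j))) ⟩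
  q^ (choose₂ (suc (suc N)) * s) ⊗ (q^ (j * s) ⊗ (w ⊞ V ⊗ p₁ ⊞ Q ⊗ p₂))
    ≈⟨ q^-rebalance _ (exponents (choose₂ (suc N))) ⟩
  q^ ((j + suc N) * s) ⊗ (u ⊗ (w ⊞ V ⊗ p₁ ⊞ Q ⊗ p₂))
    ≈⟨ ⊗-congˡ (solve 5 (λ u w p₁ p₂ Q → u :* (w :+ (con 1ℤ :+ Q) :* p₁ :+ Q :* p₂)
                                        := u :* w :+ (con 1ℤ :+ Q) :* (u :* p₁) :+ Q :* (u :* p₂)) ≐-refl u w p₁ p₂ Q) ⟩
  q^ ((j + suc N) * s) ⊗ (u ⊗ w ⊞ V ⊗ (u ⊗ p₁) ⊞ Q ⊗ (u ⊗ p₂))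
    ≈⟨ ⊗-congˡ (⊞-cong (⊞-congˡ (⊗-congˡ (≐-sym (prev-⊗ u (weighted s (N + N)) j))))
                       (⊗-congˡ (≐-sym (≐-trans (prev-cong (prev-⊗ u (weighted s (N + N))) j) (prev-⊗ u _ j))))) ⟩
  twoStep s N (normalisedBinomial s N) j ∎
  where
  open ≐-Reasoning
  u  = q^ (choose₂ (suc N) * s)
  Q  = q^ (suc (N + N) * s)
  V  = one ⊞ Q
  w  = weighted s (N + N) j
  p₁ = prev (weighted s (N + N)) j
  p₂ = prev (prev (weighted s (N + N))) j
  exponents : ∀ c → (c + suc N) * s + j * s ≡ (j + suc N) * s + c * s
  exponents c = ℕ-Ring.solve (c ∷ s ∷ N ∷ j ∷ [])

normalisedCoefficient≐normalisedBinomial : ∀ s N j → normalisedCoefficient s N j ≐ normalisedBinomial s N j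
normalisedCoefficient≐normalisedBinomial s zero    zero    = ⊗-congˡ (≐-sym (⊗-identityˡ one))
normalisedCoefficient≐normalisedBinomial s zero    (suc j) =
  ≐-trans (⊗-zeroʳ _) (≐-sym (≐-trans (⊗-congˡ (⊗-zeroʳ _)) (⊗-zeroʳ _)))
normalisedCoefficient≐normalisedBinomial s (suc N) j = begin
  normalisedCoefficient s (suc N) j          ≈⟨ normalisedCoefficient-step s N j ⟩
  twoStep s N (normalisedCoefficient s N) j  ≈⟨ twoStep-cong s N (normalisedCoefficient≐normalisedBinomial s N) j ⟩
  twoStep s N (normalisedBinomial s N) j     ≈⟨ ≐-sym (normalisedBinomial-step s N j) ⟩
  normalisedBinomial s (suc N) j             ∎
  where open ≐-Reasoning

-- Δ N j = k (k + 1) / 2 for the signed offset k = j − N.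
Δ : ℕ → ℕ → ℕ
Δ zero    j       = choose₂ (suc j)
Δ (suc N) zero    = choose₂ (suc N)
Δ (suc N) (suc j) = Δ N j

Δ-balance : ∀ N j → choose₂ (suc N) + (j + choose₂ j) ≡ suc j * N + Δ N j
Δ-balance zero    j       = arithmetic (choose₂ j)
  where
  arithmetic : ∀ c → j + c ≡ suc j * 0 + (c + j)
  arithmetic c = ℕ-Ring.solve (c ∷ j ∷ [])
Δ-balance (suc N) zero    = arithmetic (choose₂ (suc N))
  where
  arithmetic : ∀ c → c + suc N + 0 ≡ 1 * suc N + c
  arithmetic c = ℕ-Ring.solve (c ∷ N ∷ [])
Δ-balance (suc N) (suc j) = begin
  choose₂ (suc N) + suc N + (suc j + (choose₂ j + j))  ≡⟨ regroup (choose₂ (suc N)) (choose₂ j) ⟩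
  choose₂ (suc N) + (j + choose₂ j) + (N + j + 2)      ≡⟨ cong (_+ (N + j + 2)) (Δ-balance N j) ⟩
  suc j * N + Δ N j + (N + j + 2)                      ≡⟨ collect (Δ N j) ⟩
  suc (suc j) * suc N + Δ N j                          ∎
  where
  open ≡-Reasoning
  regroup : ∀ c c′ → c + suc N + (suc j + (c′ + j)) ≡ c + (j + c′) + (N + j + 2)
  regroup c c′ = ℕ-Ring.solve (c ∷ c′ ∷ N ∷ j ∷ [])
  collect : ∀ d → suc j * N + d + (N + j + 2) ≡ suc (suc j) * suc N + d
  collect d = ℕ-Ring.solve (d ∷ N ∷ j ∷ [])

Δ-balance-scaled : ∀ s N j → choose₂ (suc N) * s + j * s + choose₂ j * s ≡ (suc j * N) * s + Δ N j * s
Δ-balance-scaled s N j = begin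
  choose₂ (suc N) * s + j * s + choose₂ j * s    ≡⟨ ℕₚ.+-assoc (choose₂ (suc N) * s) _ _ ⟩
  choose₂ (suc N) * s + (j * s + choose₂ j * s)  ≡⟨ cong (choose₂ (suc N) * s +_) (ℕₚ.*-distribʳ-+ s j (choose₂ j)) ⟨
  choose₂ (suc N) * s + (j + choose₂ j) * s      ≡⟨ ℕₚ.*-distribʳ-+ s (choose₂ (suc N)) (j + choose₂ j) ⟨
  (choose₂ (suc N) + (j + choose₂ j)) * s        ≡⟨ cong (_* s) (Δ-balance N j) ⟩
  (suc j * N + Δ N j) * s                        ≡⟨ ℕₚ.*-distribʳ-+ s (suc j * N) (Δ N j) ⟩
  (suc j * N) * s + Δ N j * s                    ∎
  where open ≡-Reasoning

zCoefficient-product : ∀ s N j l → j + l ≡ N + N →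
  zCoefficient s N j ⊗ poch s j ⊗ poch s l ≐ q^ (Δ N j * s) ⊗ poch s (N + N)
zCoefficient-product s N j l j+l≡2N = q^-⊗-cancel A (begin
  q^ A ⊗ (c ⊗ Pj ⊗ Pl)                          ≈⟨ solve 4 (λ x c a b → x :* (c :* a :* b) := x :* c :* a :* b) ≐-refl (q^ A) c Pj Pl ⟩
  normalisedCoefficient s N j ⊗ Pj ⊗ Pl        ≈⟨ ⊗-congʳ (⊗-congʳ (normalisedCoefficient≐normalisedBinomial s N j)) ⟩
  u ⊗ (q^ (j * s) ⊗ e) ⊗ Pj ⊗ Pl
    ≈⟨ solve 5 (λ u y e a b → u :* (y :* e) :* a :* b := u :* y :* (e :* a :* b)) ≐-refl u (q^ (j * s)) e Pj Pl ⟩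
  u ⊗ q^ (j * s) ⊗ (e ⊗ Pj ⊗ Pl)               ≈⟨ ⊗-congˡ product ⟩
  u ⊗ q^ (j * s) ⊗ (q^ (choose₂ j * s) ⊗ P)    ≈⟨ ⊗-congʳ (≐-sym (q^-+ _ _)) ⟩
  q^ (choose₂ (suc N) * s + j * s) ⊗ (q^ (choose₂ j * s) ⊗ P)  ≈⟨ q^-rebalance P (Δ-balance-scaled s N j) ⟩
  q^ A ⊗ (q^ (Δ N j * s) ⊗ P)                  ∎)
  where
  open ≐-Reasoning
  A  = (suc j * N) * s
  c  = zCoefficient s N j
  Pj = poch s j
  Pl = poch s l
  P  = poch s (N + N)
  u  = q^ (choose₂ (suc N) * s)
  e  = esym s 0 (N + N) j
  product : e ⊗ Pj ⊗ Pl ≐ q^ (choose₂ j * s) ⊗ P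
  product = subst (λ n → esym s 0 n j ⊗ Pj ⊗ Pl ≐ q^ (choose₂ j * s) ⊗ poch s n) j+l≡2N (esym-product s j l)

zCoefficient-approximation : ∀ s N j l m K → j + l ≡ N + N → N + N ≤ K → m ≤ j → m ≤ l →
  zCoefficient (suc s) N j ⊗ poch (suc s) K ≈[ Δ N j * suc s + suc m * suc s ] q^ (Δ N j * suc s)
zCoefficient-approximation s N j l m K j+l≡2N 2N≤K m≤j m≤l =
  unit-⊗-cancel≈ P P-constant-term (begin
    P ⊗ (c ⊗ E)      ≐⟨ solve 4 (λ a b c E → a :* b :* (c :* E) := c :* a :* b :* E) ≐-refl Pj Pl c E ⟩
    c ⊗ Pj ⊗ Pl ⊗ E  ≐⟨ ⊗-congʳ (zCoefficient-product s′ N j l j+l≡2N) ⟩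
    q^ e ⊗ P₂ ⊗ E    ≐⟨ ⊗-assoc (q^ e) P₂ E ⟩
    q^ e ⊗ (P₂ ⊗ E)  ≈⟨ q^-⊗-cong≈ e (⊗-cong≈ (≈-weaken (lift m≤j) (poch-truncation s′ j≤2N))
                                             (≈-weaken (lift m≤l) (poch-truncation s′ (ℕₚ.≤-trans l≤2N 2N≤K)))) ⟩
    q^ e ⊗ P         ≐⟨ ⊗-comm (q^ e) P ⟩
    P ⊗ q^ e         ∎)
  where
  open ≈-Reasoning (Δ N j * suc s + suc m * suc s)
  s′ = suc s
  c  = zCoefficient s′ N j
  E  = poch s′ K
  Pj = poch s′ j
  Pl = poch s′ l
  P  = Pj ⊗ Pl
  P₂ = poch s′ (N + N)
  e  = Δ N j * s′
  j≤2N : j ≤ N + N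
  j≤2N = subst (j ≤_) j+l≡2N (ℕₚ.m≤m+n j l)
  l≤2N : l ≤ N + N
  l≤2N = subst (l ≤_) j+l≡2N (ℕₚ.m≤n+m l j)
  lift : ∀ {k} → m ≤ k → suc m * s′ ≤ suc k * s′
  lift m≤k = ℕₚ.*-monoˡ-≤ s′ (s≤s m≤k)
  P-constant-term : P 0 ≡ 1ℤ
  P-constant-term = trans (⊗-coeff₀ Pj Pl) (cong₂ ℤ._*_ (poch-constant-term s j) (poch-constant-term s l))

data Side : ℕ → ℕ → Set where
  atOrAbove : ∀ N d → Side N (N + d)
  below     : ∀ j d → Side (j + suc d) j

side : ∀ N j → Side N j
side zero    j       = atOrAbove 0 j
side (suc N) zero    = below 0 N
side (suc N) (suc j) with side N j
... | atOrAbove N d = atOrAbove (suc N) d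
... | below j d     = below (suc j) d

Δ-atOrAbove : ∀ N d → Δ N (N + d) ≡ choose₂ (suc d)
Δ-atOrAbove zero    d = refl
Δ-atOrAbove (suc N) d = Δ-atOrAbove N d

Δ-below : ∀ j d → Δ (j + suc d) j ≡ choose₂ (suc d)
Δ-below zero    d = refl
Δ-below (suc j) d = Δ-below j d

Δ-symmetric : ∀ N i → i < N + N → Δ N (N + N ∸ suc i) ≡ Δ N i
Δ-symmetric N i i<2N with side N i
... | atOrAbove N d = begin
  Δ N (N + N ∸ suc (N + d))          ≡⟨ cong (Δ N) (trans (cong (N + N ∸_) (sym (ℕₚ.+-suc N d))) (ℕₚ.[m+n]∸[m+o]≡n∸o N N (suc d))) ⟩
  Δ N (N ∸ suc d)                    ≡⟨ cong (λ M → Δ M (N ∸ suc d)) (sym (ℕₚ.m∸n+n≡m d<N)) ⟩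
  Δ (N ∸ suc d + suc d) (N ∸ suc d)  ≡⟨ Δ-below (N ∸ suc d) d ⟩
  choose₂ (suc d)                    ≡⟨ Δ-atOrAbove N d ⟨
  Δ N (N + d)                        ∎
  where
  open ≡-Reasoning
  d<N : d < N
  d<N = ℕₚ.+-cancelˡ-< N d N i<2N
... | below j d = begin
  Δ N (N + N ∸ suc j)  ≡⟨ cong (Δ N) (trans (cong (_∸ suc j) regroup) (ℕₚ.m+n∸m≡n (suc j) (N + d))) ⟩
  Δ N (N + d)          ≡⟨ Δ-atOrAbove N d ⟩
  choose₂ (suc d)      ≡⟨ Δ-below j d ⟨
  Δ N j                ∎
  where
  open ≡-Reasoning
  regroup : j + suc d + (j + suc d) ≡ suc j + (j + suc d + d)
  regroup = ℕ-Ring.solve (j ∷ d ∷ [])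

n≤choose₂[1+n] : ∀ n → n ≤ choose₂ (suc n)
n≤choose₂[1+n] n = ℕₚ.m≤n+m n (choose₂ n)

+-≤-scaled : ∀ a b s → a + b ≤ a * suc s + b * suc s
+-≤-scaled a b s = ℕₚ.+-mono-≤ (ℕₚ.m≤m*n a (suc s)) (ℕₚ.m≤m*n b (suc s))

zCoefficient-≈ : ∀ s N j K → j ≤ N + N → N + N ≤ K →
  zCoefficient (suc s) N j ⊗ poch (suc s) K ≈[ N ] q^ (Δ N j * suc s)
zCoefficient-≈ s N j K j≤2N 2N≤K with side N j
... | atOrAbove N d = ≈-weaken (ℕₚ.≤-trans N≤ (+-≤-scaled (Δ N (N + d)) (suc (N ∸ d)) s))
  (zCoefficient-approximation s N (N + d) (N ∸ d) (N ∸ d) K sum 2N≤K (ℕₚ.≤-trans (ℕₚ.m∸n≤m N d) (ℕₚ.m≤m+n N d)) ℕₚ.≤-refl)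
  where
  d≤N : d ≤ N
  d≤N = ℕₚ.+-cancelˡ-≤ N d N j≤2N
  sum : N + d + (N ∸ d) ≡ N + N
  sum = trans (ℕₚ.+-assoc N d (N ∸ d)) (cong (N +_) (ℕₚ.m+[n∸m]≡n d≤N))
  N≤ : N ≤ Δ N (N + d) + suc (N ∸ d)
  N≤ = begin
    N                              ≡⟨ ℕₚ.m+[n∸m]≡n d≤N ⟨
    d + (N ∸ d)                    ≤⟨ ℕₚ.+-monoʳ-≤ d (ℕₚ.n≤1+n _) ⟩
    d + suc (N ∸ d)                ≤⟨ ℕₚ.+-monoˡ-≤ _ (n≤choose₂[1+n] d) ⟩
    choose₂ (suc d) + suc (N ∸ d)  ≡⟨ cong (_+ suc (N ∸ d)) (Δ-atOrAbove N d) ⟨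
    Δ N (N + d) + suc (N ∸ d)      ∎
    where open ℕₚ.≤-Reasoning
... | below j d = ≈-weaken (ℕₚ.≤-trans N≤ (+-≤-scaled (Δ (j + suc d) j) (suc j) s))
  (zCoefficient-approximation s N j (suc d + N) j K sum 2N≤K ℕₚ.≤-refl (ℕₚ.≤-trans (ℕₚ.m≤m+n j (suc d)) (ℕₚ.m≤n+m _ (suc d))))
  where
  sum : j + (suc d + (j + suc d)) ≡ j + suc d + (j + suc d)
  sum = sym (ℕₚ.+-assoc j (suc d) (j + suc d))
  N≤ : j + suc d ≤ Δ (j + suc d) j + suc j
  N≤ = begin
    j + suc d                ≡⟨ ℕₚ.+-suc j d ⟩
    suc j + d                ≡⟨ ℕₚ.+-comm (suc j) d ⟩
    d + suc j                ≤⟨ ℕₚ.+-monoˡ-≤ _ (n≤choose₂[1+n] d) ⟩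
    choose₂ (suc d) + suc j  ≡⟨ cong (_+ suc j) (Δ-below j d) ⟨
    Δ (j + suc d) j + suc j  ∎
    where open ℕₚ.≤-Reasoning

-- Both sides against a theta series

-- ∑_{−N ≤ k < N} q^(k (k + 1))
theta : ℕ → Series
theta N = ∑ˢ (N + N) (λ i → q^ (Δ N i * 2))

prodL-approximation : ∀ N K → N + N ≤ K → prodL N -1ℤ ⊗ (poch 1 K ⊗ poch 1 K) ≈[ N ] theta N
prodL-approximation N K 2N≤K = begin
  prodL N -1ℤ ⊗ (E ⊗ E)
    ≐⟨ ⊗-congʳ (≐-trans (prodL-as-square N -1ℤ) (square-coefficient 1 N)) ⟩
  ∑ˢ (N + N) (λ i → c i ⊗ c (partner i)) ⊗ (E ⊗ E)
    ≐⟨ ∑ˢ-⊗ (N + N) (E ⊗ E) (λ i → c i ⊗ c (partner i)) ⟩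
  ∑ˢ (N + N) (λ i → c i ⊗ c (partner i) ⊗ (E ⊗ E))
    ≈⟨ ∑ˢ-cong≈ (N + N) term ⟩
  theta N ∎
  where
  open ≈-Reasoning N
  c = zCoefficient 1 N
  E = poch 1 K
  partner : ℕ → ℕ
  partner i = N + N ∸ suc i
  term : ∀ i → i < N + N → c i ⊗ c (partner i) ⊗ (E ⊗ E) ≈[ N ] q^ (Δ N i * 2)
  term i i<2N = begin
    c i ⊗ c (partner i) ⊗ (E ⊗ E)
      ≐⟨ solve 3 (λ x y e → x :* y :* (e :* e) := x :* e :* (y :* e)) ≐-refl (c i) (c (partner i)) E ⟩
    c i ⊗ E ⊗ (c (partner i) ⊗ E)
      ≈⟨ ⊗-cong≈ (zCoefficient-≈ 0 N i K (ℕₚ.<⇒≤ i<2N) 2N≤K)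
                 (zCoefficient-≈ 0 N (partner i) K (ℕₚ.m∸n≤m (N + N) (suc i)) 2N≤K) ⟩
    q^ (Δ N i * 1) ⊗ q^ (Δ N (partner i) * 1)
      ≐⟨ ≐-sym (q^-+ _ _) ⟩
    q^ (Δ N i * 1 + Δ N (partner i) * 1)
      ≡⟨ cong q^_ (trans (cong (λ e → Δ N i * 1 + e * 1) (Δ-symmetric N i i<2N)) (double (Δ N i))) ⟩
    q^ (Δ N i * 2) ∎
    where
    double : ∀ e → e * 1 + e * 1 ≡ e * 2
    double e = ℕ-Ring.solve (e ∷ [])

gauss-approximation : ∀ N K → N + N ≤ K → factorsAtOne 2 N ⊗ poch 2 K ≈[ N ] theta N
gauss-approximation N K 2N≤K = begin
  factorsAtOne 2 N ⊗ E
    ≐⟨ ⊗-congʳ (≐-trans (≐-sym (timesFactors-one 2 N 0ℤ)) (timesFactors-expansion 2 N (λ _ → one) 0ℤ)) ⟩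
  ∑ˢ (suc (N + N)) (λ i → c i ⊗ one) ⊗ E
    ≐⟨ ∑ˢ-⊗ (suc (N + N)) E (λ i → c i ⊗ one) ⟩
  ∑ˢ (suc (N + N)) (λ i → c i ⊗ one ⊗ E)
    ≈⟨ ∑ˢ-cong≈ (suc (N + N)) (λ i i≤2N → ≈-trans (≐⇒≈ (⊗-congʳ (⊗-identityʳ (c i))))
                                                  (zCoefficient-≈ 1 N i K (ℕₚ.≤-pred i≤2N) 2N≤K)) ⟩
  ∑ˢ (suc (N + N)) (λ i → q^ (Δ N i * 2))
    ≐⟨ ∑ˢ-last (N + N) (λ i → q^ (Δ N i * 2)) ⟩
  theta N ⊞ q^ (Δ N (N + N) * 2)
    ≈⟨ ⊞-cong≈ ≈-refl (q^-≈0 _ (ℕₚ.≤-trans large (ℕₚ.m≤m*n _ 2))) ⟩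
  theta N ⊞ 0ˢ
    ≐⟨ ⊞-identityʳ (theta N) ⟩
  theta N ∎
  where
  open ≈-Reasoning N
  c = zCoefficient 2 N
  E = poch 2 K
  large : N ≤ Δ N (N + N)
  large = subst (N ≤_) (sym (Δ-atOrAbove N N)) (n≤choose₂[1+n] N)

invOneMinus-inverse : ∀ i → invOneMinus (suc i) ⊗ 1- q^ (suc i) ≐ one
invOneMinus-inverse i =
  ≐-trans (solve 2 (λ u q → u :* (con 1ℤ :- q) := u :- q :* u) ≐-refl u (q^ (suc i))) (coeffwise coeffAt)
  where
  u = invOneMinus (suc i)
  coeffAt : ∀ n → (u ⊞ ⊟ (q^ (suc i) ⊗ u)) n ≡ one n
  coeffAt n with offset (suc i) n
  ... | below n<i = begin
    (u ⊞ ⊟ (q^ (suc i) ⊗ u)) n      ≡⟨ trans (⊞-coeff u _ n) (cong (ℤ._+_ (u n)) (⊟-coeff _ n)) ⟩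
    u n ℤ.+ ℤ.- (q^ (suc i) ⊗ u) n  ≡⟨ cong (λ x → u n ℤ.+ ℤ.- x) (q^-⊗-below (suc i) u n n<i) ⟩
    u n ℤ.+ 0ℤ                      ≡⟨ ℤₚ.+-identityʳ (u n) ⟩
    u n                             ≡⟨ initial n n<i ⟩
    one n                           ∎
    where
    open ≡-Reasoning
    initial : ∀ n → n < suc i → u n ≡ one n
    initial zero    _   = refl
    initial (suc n) n<i = cong (λ b → if b then 1ℤ else 0ℤ) (dec-false (suc i ∣? suc n) (λ i∣n → ℕₚ.<⇒≱ n<i (∣⇒≤ i∣n)))
  ... | above m = begin
    (u ⊞ ⊟ (q^ (suc i) ⊗ u)) (suc i + m)
      ≡⟨ trans (⊞-coeff u _ (suc i + m)) (cong (ℤ._+_ (u (suc i + m))) (⊟-coeff _ (suc i + m))) ⟩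
    u (suc i + m) ℤ.+ ℤ.- (q^ (suc i) ⊗ u) (suc i + m)  ≡⟨ cong (λ x → u (suc i + m) ℤ.+ ℤ.- x) (q^-⊗-above (suc i) u m) ⟩
    u (suc i + m) ℤ.+ ℤ.- u m                           ≡⟨ cong (λ x → x ℤ.+ ℤ.- u m) periodic ⟩
    u m ℤ.+ ℤ.- u m                                     ≡⟨ ℤₚ.+-inverseʳ (u m) ⟩
    0ℤ                                                  ≡⟨ mono-≢ 1ℤ 0 (suc i + m) (λ ()) ⟨
    one (suc i + m)                                     ∎
    where
    open ≡-Reasoning
    periodic : u (suc i + m) ≡ u m
    periodic = cong (λ b → if b then 1ℤ else 0ℤ) (same-does (suc i ∣? (suc i + m)) (suc i ∣? m))
      where
      same-does : (p : Dec (suc i ∣ suc i + m)) (q : Dec (suc i ∣ m)) → does p ≡ does q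
      same-does (yes _)   (yes _)   = refl
      same-does (no _)    (no _)    = refl
      same-does (yes i∣)  (no ¬i∣)  = ⊥-elim (¬i∣ (∣m+n∣m⇒∣n i∣ ∣-refl))
      same-does (no ¬i∣)  (yes i∣)  = ⊥-elim (¬i∣ (∣m∣n⇒∣m+n ∣-refl i∣))

factorR-as-⊗ : ∀ M → factorR (suc M) ≐
  1- q^ (suc M * 2) ⊗ ((one ⊞ q^ (suc M * 2)) ⊗ ((one ⊞ q^ (M * 2)) ⊗ (invOneMinus (suc M) ⊗ invOneMinus (suc M))))
factorR-as-⊗ M =
  ≐-trans (⊛-as-⊗ _ _) (⊗-cong (≐-trans (⊕-as-⊞ _ _) (⊞-congˡ (≐-trans (mono-neg _) (⊟-cong (q^-exponent double)))))
  (≐-trans (⊛-as-⊗ _ _) (⊗-cong (≐-trans (⊕-as-⊞ _ _) (⊞-congˡ (q^-exponent double)))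
  (≐-trans (⊛-as-⊗ _ _) (⊗-cong (≐-trans (⊕-as-⊞ _ _) (⊞-congˡ (q^-exponent previous))) (⊛-as-⊗ _ _))))))
  where
  double : 2 * suc M ≡ suc M * 2
  double = ℕₚ.*-comm 2 (suc M)
  previous : 2 * suc M ∸ 2 ≡ M * 2
  previous = trans (cong (_∸ 2) expand) (ℕₚ.m+n∸m≡n 2 (M * 2))
    where
    expand : 2 * suc M ≡ 2 + M * 2
    expand = ℕ-Ring.solve (M ∷ [])

cancel-inverse-squares : ∀ X P P₂ G a b d u o → u ⊗ o ≐ one → X ⊗ (P ⊗ P) ≐ P₂ ⊗ G →
  X ⊗ (a ⊗ (b ⊗ (d ⊗ (u ⊗ u)))) ⊗ (P ⊗ o ⊗ (P ⊗ o)) ≐ P₂ ⊗ a ⊗ (b ⊗ (d ⊗ G))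
cancel-inverse-squares X P P₂ G a b d u o uo≐1 h = begin
  X ⊗ (a ⊗ (b ⊗ (d ⊗ (u ⊗ u)))) ⊗ (P ⊗ o ⊗ (P ⊗ o))
    ≈⟨ solve 7 (λ X P a b d u o → X :* (a :* (b :* (d :* (u :* u)))) :* (P :* o :* (P :* o))
                                 := X :* (P :* P) :* (a :* (b :* d)) :* (u :* o :* (u :* o))) ≐-refl X P a b d u o ⟩
  X ⊗ (P ⊗ P) ⊗ (a ⊗ (b ⊗ d)) ⊗ (u ⊗ o ⊗ (u ⊗ o))
    ≈⟨ ⊗-cong (⊗-congʳ h) (⊗-cong uo≐1 uo≐1) ⟩
  P₂ ⊗ G ⊗ (a ⊗ (b ⊗ d)) ⊗ (one ⊗ one)
    ≈⟨ solve 5 (λ P₂ G a b d → P₂ :* G :* (a :* (b :* d)) :* (con 1ℤ :* con 1ℤ) := P₂ :* a :* (b :* (d :* G))) ≐-refl P₂ G a b d ⟩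
  P₂ ⊗ a ⊗ (b ⊗ (d ⊗ G)) ∎
  where open ≐-Reasoning

prodR-times-pochSquare : ∀ M → prodR M ⊗ (poch 1 M ⊗ poch 1 M) ≐ poch 2 M ⊗ factorsAtOne 2 M
prodR-times-pochSquare zero    = ⊗-congˡ (⊗-identityˡ one)
prodR-times-pochSquare (suc M) = begin
  prodR M ⊛ factorR (suc M) ⊗ (poch 1 M ⊗ o′ ⊗ (poch 1 M ⊗ o′))
    ≈⟨ ⊗-cong (≐-trans (⊛-as-⊗ _ _) (⊗-congˡ (factorR-as-⊗ M))) (⊗-cong (⊗-congˡ o′≐o) (⊗-congˡ o′≐o)) ⟩
  prodR M ⊗ (a ⊗ (b ⊗ (d ⊗ (u ⊗ u)))) ⊗ (poch 1 M ⊗ o ⊗ (poch 1 M ⊗ o))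
    ≈⟨ cancel-inverse-squares (prodR M) (poch 1 M) (poch 2 M) (factorsAtOne 2 M) a b d u o
                              (invOneMinus-inverse M) (prodR-times-pochSquare M) ⟩
  poch 2 M ⊗ a ⊗ (b ⊗ (d ⊗ factorsAtOne 2 M)) ∎
  where
  open ≐-Reasoning
  a  = 1- q^ (suc M * 2)
  b  = one ⊞ q^ (suc M * 2)
  d  = one ⊞ q^ (M * 2)
  u  = invOneMinus (suc M)
  o  = 1- q^ (suc M)
  o′ = 1- q^ (suc M * 1)
  o′≐o : o′ ≐ o
  o′≐o = 1-‿cong (q^-exponent (ℕₚ.*-identityʳ (suc M)))

prodR-approximation : ∀ n N M K → n < N → n < M → N + N ≤ K → M ≤ K →
  prodR M ⊗ (poch 1 K ⊗ poch 1 K) ≈[ suc n ] theta N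
prodR-approximation n N M K n<N n<M 2N≤K M≤K = begin
  prodR M ⊗ (poch 1 K ⊗ poch 1 K)  ≈⟨ ⊗-cong≈ ≈-refl (⊗-cong≈ pochK≈pochM pochK≈pochM) ⟩
  prodR M ⊗ (poch 1 M ⊗ poch 1 M)  ≐⟨ prodR-times-pochSquare M ⟩
  poch 2 M ⊗ factorsAtOne 2 M      ≈⟨ ⊗-cong≈ (≈-sym (≈-weaken (withinM 1) (poch-truncation 2 M≤K))) factorsM≈factorsN ⟩
  poch 2 K ⊗ factorsAtOne 2 N      ≐⟨ ⊗-comm (poch 2 K) (factorsAtOne 2 N) ⟩
  factorsAtOne 2 N ⊗ poch 2 K      ≈⟨ ≈-weaken n<N (gauss-approximation N K 2N≤K) ⟩
  theta N                          ∎
  where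
  open ≈-Reasoning (suc n)
  withinM : ∀ s → suc n ≤ suc M * suc s
  withinM s = ℕₚ.≤-trans (s≤s (ℕₚ.<⇒≤ n<M)) (ℕₚ.m≤m*n (suc M) (suc s))
  pochK≈pochM : poch 1 K ≈[ suc n ] poch 1 M
  pochK≈pochM = ≈-weaken (withinM 0) (poch-truncation 1 M≤K)
  factorsM≈factorsN : factorsAtOne 2 M ≈[ suc n ] factorsAtOne 2 N
  factorsM≈factorsN = ≈-weaken (ℕₚ.m≤m*n (suc n) 2)
    (≈-trans (factorsAtOne-truncation 2 n<M) (≈-sym (factorsAtOne-truncation 2 n<N)))

corollary4 : (n N M : ℕ) → n < N → n < M →
    prodL N -1ℤ n ≡ prodR M n
corollary4 n N M n<N n<M = sym (agree (unit-⊗-cancel≈ E² E²-constant-term agreement) n ℕₚ.≤-refl)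
  where
  K  = N + N + M
  E² = poch 1 K ⊗ poch 1 K
  E²-constant-term : E² 0 ≡ 1ℤ
  E²-constant-term = trans (⊗-coeff₀ (poch 1 K) (poch 1 K)) (cong₂ ℤ._*_ (poch-constant-term 0 K) (poch-constant-term 0 K))
  agreement : E² ⊗ prodR M ≈[ suc n ] E² ⊗ prodL N -1ℤ
  agreement = begin
    E² ⊗ prodR M      ≐⟨ ⊗-comm E² (prodR M) ⟩
    prodR M ⊗ E²      ≈⟨ prodR-approximation n N M K n<N n<M (ℕₚ.m≤m+n (N + N) M) (ℕₚ.m≤n+m M (N + N)) ⟩
    theta N           ≈⟨ ≈-sym (≈-weaken n<N (prodL-approximation N K (ℕₚ.m≤m+n (N + N) M))) ⟩
    prodL N -1ℤ ⊗ E²  ≐⟨ ⊗-comm (prodL N -1ℤ) E² ⟩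
    E² ⊗ prodL N -1ℤ  ∎
    where open ≈-Reasoning (suc n)
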